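{- As formal power series in $q$, $$\sum_{n\geq 0}\overline{R_6^\ast}(18n+2)q^n\equiv 4f_1^3 \pmod{8},$$ meaning the coefficients of $q^n$ on both sides agree modulo $8$ for every $n$.
   Context: Here $f_k:=\prod_{i\geq 1}(1-q^{ki})$. An overpartition of $n$ is a partition of $n$ in which the first occurrence of each part size may optionally be overlined. For a positive integer $\ell$, $\overline{R_\ell^\ast}(n)$ denotes the number of overpartitions of $n$ in which no non-overlined part is divisible by $\ell$; its generating function is $\sum_{n\geq 0}\overline{R_\ell^\ast}(n)q^n = \frac{f_2 f_\ell}{f_1^2}$. -}

module Defs where

open import Data.Nat as ℕ using (ℕ; zero; suc; _∸_)
open import Data.Nat.Divisibility using (_∣?_)
open import Data.Integer using (ℤ; +_; -_; _+_; _*_)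
open import Relation.Nullary using (yes; no)

-- Formal power series over ℤ in q, represented by their coefficient
-- functions:  s n = coefficient of q^n.
Series : Set
Series = ℕ → ℤ

sumTo : ℕ → (ℕ → ℤ) → ℤ
sumTo zero    g = g 0
sumTo (suc n) g = sumTo n g + g (suc n)

infixl 7 _⊛_
_⊛_ : Series → Series → Series
(a ⊛ b) n = sumTo n (λ k → a k * b (n ∸ k))

oneS : Series
oneS zero    = + 1
oneS (suc _) = + 0

-- The polynomial 1 - q^d  (used only with d ≥ 1).
oneMinusQ^ : ℕ → Series
oneMinusQ^ d zero = + 1
oneMinusQ^ d (suc n) with suc n ℕ.≟ d
... | yes _ = - (+ 1)
... | no  _ = + 0

-- The geometric series 1/(1 - q^d) = Σ_{j ≥ 0} q^{d j}  (used only with d ≥ 1).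
geomQ^ : ℕ → Series
geomQ^ d n with d ∣? n
... | yes _ = + 1
... | no  _ = + 0

prodTo : ℕ → (ℕ → Series) → Series
prodTo zero    F = oneS
prodTo (suc m) F = prodTo m F ⊛ F (suc m)

-- f k = ∏_{i ≥ 1} (1 - q^{k i}),  k ≥ 1.  The coefficient of q^n only depends
-- on the factors with i ≤ n, so we take the n-th coefficient of the
-- finite product over 1 ≤ i ≤ n.
f : ℕ → Series
f k n = prodTo n (λ i → oneMinusQ^ (k ℕ.* i)) n

-- 1 / f k = ∏_{i ≥ 1} 1/(1 - q^{k i}),  k ≥ 1, truncated the same way.
invf : ℕ → Series
invf k n = prodTo n (λ i → geomQ^ (k ℕ.* i)) n

-- Generating function of overpartitions with no non-overlined part
-- divisible by ℓ:  Σ R̄*_ℓ(n) q^n = f₂ f_ℓ / f₁².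
Rbar* : ℕ → ℕ → ℤ
Rbar* ℓ = f 2 ⊛ f ℓ ⊛ invf 1 ⊛ invf 1

-- By Jacobi's triple product, θ₀ = Σ_k (-1)^k q^(k²) = f₁²/f₂, so the generating
-- function of R̄*₆ is f₆/θ₀. Writing θ₀ = 1 + 2T with T = Σ_{k ≥ 1} (-1)^k q^(k²), one has
-- 1/θ₀ ≡ 1 - 2T + 4T² (mod 8). As f₆ is a series in q⁶, the coefficients of q^(6n + 2) only see
-- those of 1 - 2T + 4T² at 6n + 2: there 1 and T vanish (no square is 2 mod 3), while
-- T² ≡ T(q²) (mod 2) contributes 4 T at 3n + 1, which is -4 θ₂ with θ₂ = Σ_k (-1)^k q^(3k² + 2k).
-- The triple product again gives θ₂ = f₁ f₆² / (f₂ f₃), and with f₁² ≡ f₂, f₆ ≡ f₃² (mod 2),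
-- Σ R̄*₆(6n + 2) qⁿ ≡ 4 f₁ θ₂ ≡ 4 f₃³ (mod 8); the coefficients of q^(3n) of f₃³ are those of f₁³.

module Submission where

open import Defs
open import Level using (0ℓ)
open import Function using (_∘_)
open import Data.Empty using (⊥-elim)
open import Data.Product using (Σ; _,_; _×_)
open import Data.Sum using (_⊎_; inj₁; inj₂)
open import Data.Maybe using (Maybe; just; nothing)
open import Relation.Nullary using (Dec; yes; no; ¬_)
open import Relation.Binary.PropositionalEquality
open import Relation.Binary.Bundles using (Setoid)
open import Relation.Binary.Definitions using (Tri; tri<; tri≈; tri>)
import Relation.Binary.Reasoning.Setoid as SetoidReasoning

import Data.Nat
open import Data.Nat as ℕ using (ℕ; zero; suc; _∸_; _≤_; _<_; z≤n; s≤s)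
import Data.Nat.Properties as ℕₚ
import Data.Nat.Divisibility as ℕ∣
open import Data.Nat.DivMod using (_/_; _%_; m≡m%n+[m/n]*n; m%n<n; [m+kn]%n≡m%n; m<n⇒m%n≡m)
import Data.Nat.Tactic.RingSolver as ℕ-Solver
open import Data.Integer as ℤ using (ℤ; +_; -_; _+_; _*_; _-_; _⊖_; 0ℤ; 1ℤ; -1ℤ)
import Data.Integer.Properties as ℤₚ
open import Data.Integer.Divisibility using (_∣_)
open import Data.Integer.Divisibility.Signed as ℤ∣ using (divides) renaming (_∣_ to _∣ℤ_)
open import Data.Integer.Tactic.RingSolver using (solve-∀)

open import Algebra.Bundles using (CommutativeRing)
open import Algebra.Structures using (IsAbelianGroup)
open import Algebra.Properties.CommutativeSemigroup ℤₚ.+-commutativeSemigroup using (interchange)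
import Algebra.Solver.Ring
import Algebra.Solver.Ring.AlmostCommutativeRing as ACR

-- Finite sums

sumTo-cong : ∀ n {g h : ℕ → ℤ} → (∀ k → k ≤ n → g k ≡ h k) → sumTo n g ≡ sumTo n h
sumTo-cong zero    g≡h = g≡h 0 z≤n
sumTo-cong (suc n) g≡h =
  cong₂ _+_ (sumTo-cong n λ k k≤n → g≡h k (ℕₚ.m≤n⇒m≤1+n k≤n)) (g≡h (suc n) ℕₚ.≤-refl)

sumTo-zero : ∀ n {g : ℕ → ℤ} → (∀ k → k ≤ n → g k ≡ 0ℤ) → sumTo n g ≡ 0ℤ
sumTo-zero zero    g≡0 = g≡0 0 z≤n
sumTo-zero (suc n) g≡0 =
  cong₂ _+_ (sumTo-zero n λ k k≤n → g≡0 k (ℕₚ.m≤n⇒m≤1+n k≤n)) (g≡0 (suc n) ℕₚ.≤-refl)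

sumTo-+ : ∀ n (g h : ℕ → ℤ) → sumTo n (λ k → g k + h k) ≡ sumTo n g + sumTo n h
sumTo-+ zero    g h = refl
sumTo-+ (suc n) g h = trans (cong (_+ (g (suc n) + h (suc n))) (sumTo-+ n g h))
                            (interchange (sumTo n g) (sumTo n h) (g (suc n)) (h (suc n)))

sumTo-*ˡ : ∀ n c (g : ℕ → ℤ) → sumTo n (λ k → c * g k) ≡ c * sumTo n g
sumTo-*ˡ zero    c g = refl
sumTo-*ˡ (suc n) c g = trans (cong (_+ c * g (suc n)) (sumTo-*ˡ n c g))
                             (sym (ℤₚ.*-distribˡ-+ c (sumTo n g) (g (suc n))))

sumTo-*ʳ : ∀ n c (g : ℕ → ℤ) → sumTo n (λ k → g k * c) ≡ sumTo n g * c
sumTo-*ʳ n c g = trans (sumTo-cong n λ k _ → ℤₚ.*-comm (g k) c)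
                       (trans (sumTo-*ˡ n c g) (ℤₚ.*-comm c (sumTo n g)))

sumTo-neg : ∀ n (g : ℕ → ℤ) → sumTo n (λ k → - g k) ≡ - sumTo n g
sumTo-neg n g = trans (sumTo-cong n λ k _ → sym (ℤₚ.-1*i≡-i (g k)))
                      (trans (sumTo-*ˡ n -1ℤ g) (ℤₚ.-1*i≡-i (sumTo n g)))

sumTo-shift : ∀ n (g : ℕ → ℤ) → sumTo (suc n) g ≡ g 0 + sumTo n (λ k → g (suc k))
sumTo-shift zero    g = refl
sumTo-shift (suc n) g = trans (cong (_+ g (suc (suc n))) (sumTo-shift n g)) (ℤₚ.+-assoc (g 0) _ _)

sumTo-reverse : ∀ n (g : ℕ → ℤ) → sumTo n g ≡ sumTo n (λ k → g (n ∸ k))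
sumTo-reverse zero    g = refl
sumTo-reverse (suc n) g = begin
  sumTo n g + g (suc n)                  ≡⟨ cong (_+ g (suc n)) (sumTo-reverse n g) ⟩
  sumTo n (λ k → g (n ∸ k)) + g (suc n)  ≡⟨ ℤₚ.+-comm _ (g (suc n)) ⟩
  g (suc n) + sumTo n (λ k → g (n ∸ k))  ≡⟨ sym (sumTo-shift n (λ k → g (suc n ∸ k))) ⟩
  sumTo (suc n) (λ k → g (suc n ∸ k))    ∎
  where open ≡-Reasoning

sumTo-single : ∀ n e {g : ℕ → ℤ} → e ≤ n → (∀ k → k ≢ e → g k ≡ 0ℤ) → sumTo n g ≡ g e
sumTo-single zero    .zero z≤n g≡0 = refl
sumTo-single (suc n) e {g} e≤n g≡0 with e ℕ.≟ suc n
... | yes refl =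
  trans (cong (_+ g (suc n)) (sumTo-zero n λ k k≤n → g≡0 k λ { refl → ℕₚ.<-irrefl refl (s≤s k≤n) }))
        (ℤₚ.+-identityˡ (g (suc n)))
... | no e≢1+n =
  trans (cong₂ _+_ (sumTo-single n e (ℕₚ.≤-pred (ℕₚ.≤∧≢⇒< e≤n e≢1+n)) g≡0) (g≡0 (suc n) (e≢1+n ∘ sym)))
        (ℤₚ.+-identityʳ (g e))

sumTo-triangle : ∀ n (H : ℕ → ℕ → ℤ) →
  sumTo n (λ k → sumTo k (λ i → H i (k ∸ i))) ≡ sumTo n (λ i → sumTo (n ∸ i) (H i))
sumTo-triangle zero    H = refl
sumTo-triangle (suc n) H = begin
  sumTo n (λ k → sumTo k (λ i → H i (k ∸ i))) + (diagonal + H (suc n) (n ∸ n))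
    ≡⟨ cong (_+ (diagonal + H (suc n) (n ∸ n))) (sumTo-triangle n H) ⟩
  sumTo n (λ i → sumTo (n ∸ i) (H i)) + (diagonal + H (suc n) (n ∸ n))
    ≡⟨ sym (ℤₚ.+-assoc (sumTo n (λ i → sumTo (n ∸ i) (H i))) diagonal _) ⟩
  sumTo n (λ i → sumTo (n ∸ i) (H i)) + diagonal + H (suc n) (n ∸ n)
    ≡⟨ cong₂ _+_ (sym (sumTo-+ n _ _)) (cong (H (suc n)) (ℕₚ.n∸n≡0 n)) ⟩
  sumTo n (λ i → sumTo (n ∸ i) (H i) + H i (suc n ∸ i)) + H (suc n) 0
    ≡⟨ cong (_+ H (suc n) 0) (sumTo-cong n λ i i≤n →
         cong (λ m → sumTo (n ∸ i) (H i) + H i m) (ℕₚ.+-∸-assoc 1 i≤n)) ⟩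
  sumTo n (λ i → sumTo (suc (n ∸ i)) (H i)) + H (suc n) 0
    ≡⟨ cong (_+ H (suc n) 0) (sumTo-cong n λ i i≤n → cong (λ m → sumTo m (H i)) (sym (ℕₚ.+-∸-assoc 1 i≤n))) ⟩
  sumTo n (λ i → sumTo (suc n ∸ i) (H i)) + H (suc n) 0
    ≡⟨ cong (λ m → sumTo n (λ i → sumTo (suc n ∸ i) (H i)) + sumTo m (H (suc n))) (sym (ℕₚ.n∸n≡0 n)) ⟩
  sumTo (suc n) (λ i → sumTo (suc n ∸ i) (H i)) ∎
  where
  open ≡-Reasoning
  diagonal = sumTo n (λ i → H i (suc n ∸ i))

-- The ring of formal power series

infix 4 _≈_
record _≈_ (a b : Series) : Set where
  constructor coeffwise
  field coeff : ∀ n → a n ≡ b n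
open _≈_ public

infixl 6 _⊕_
_⊕_ : Series → Series → Series
(a ⊕ b) n = a n + b n

⊝_ : Series → Series
(⊝ a) n = - a n

zeroS : Series
zeroS _ = 0ℤ

infixl 7 _·_
_·_ : ℤ → Series → Series
(c · a) n = c * a n

≈-refl : ∀ {a} → a ≈ a
≈-refl = coeffwise λ _ → refl

≈-sym : ∀ {a b} → a ≈ b → b ≈ a
≈-sym a≈b = coeffwise λ n → sym (coeff a≈b n)

≈-trans : ∀ {a b c} → a ≈ b → b ≈ c → a ≈ c
≈-trans a≈b b≈c = coeffwise λ n → trans (coeff a≈b n) (coeff b≈c n)

≡⇒≈ : ∀ {a b} → a ≡ b → a ≈ b
≡⇒≈ refl = ≈-refl

⊕-cong : ∀ {a a′ b b′} → a ≈ a′ → b ≈ b′ → a ⊕ b ≈ a′ ⊕ b′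
⊕-cong a≈a′ b≈b′ = coeffwise λ n → cong₂ _+_ (coeff a≈a′ n) (coeff b≈b′ n)

⊝-cong : ∀ {a b} → a ≈ b → ⊝ a ≈ ⊝ b
⊝-cong a≈b = coeffwise λ n → cong -_ (coeff a≈b n)

⊛-cong : ∀ {a a′ b b′} → a ≈ a′ → b ≈ b′ → a ⊛ b ≈ a′ ⊛ b′
⊛-cong a≈a′ b≈b′ = coeffwise λ n → sumTo-cong n λ k _ → cong₂ _*_ (coeff a≈a′ k) (coeff b≈b′ (n ∸ k))

⊛-congˡ : ∀ a {b b′} → b ≈ b′ → a ⊛ b ≈ a ⊛ b′
⊛-congˡ a = ⊛-cong (≈-refl {a})

⊛-congʳ : ∀ b {a a′} → a ≈ a′ → a ⊛ b ≈ a′ ⊛ b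
⊛-congʳ b a≈a′ = ⊛-cong a≈a′ (≈-refl {b})

⊕-congˡ : ∀ a {b b′} → b ≈ b′ → a ⊕ b ≈ a ⊕ b′
⊕-congˡ a = ⊕-cong (≈-refl {a})

⊕-congʳ : ∀ b {a a′} → a ≈ a′ → a ⊕ b ≈ a′ ⊕ b
⊕-congʳ b a≈a′ = ⊕-cong a≈a′ (≈-refl {b})

⊛-comm : ∀ a b → a ⊛ b ≈ b ⊛ a
⊛-comm a b = coeffwise λ n → trans (sumTo-reverse n _) (sumTo-cong n λ k k≤n →
  trans (cong (λ m → a (n ∸ k) * b m) (ℕₚ.m∸[m∸n]≡n k≤n)) (ℤₚ.*-comm (a (n ∸ k)) (b k)))

⊛-distribˡ : ∀ a b c → a ⊛ (b ⊕ c) ≈ a ⊛ b ⊕ a ⊛ c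
⊛-distribˡ a b c = coeffwise λ n → trans (sumTo-cong n λ k _ → ℤₚ.*-distribˡ-+ (a k) _ _) (sumTo-+ n _ _)

⊛-distribʳ : ∀ a b c → (b ⊕ c) ⊛ a ≈ b ⊛ a ⊕ c ⊛ a
⊛-distribʳ a b c = ≈-trans (⊛-comm (b ⊕ c) a)
  (≈-trans (⊛-distribˡ a b c) (⊕-cong (⊛-comm a b) (⊛-comm a c)))

·-⊛ : ∀ c a b → (c · a) ⊛ b ≈ c · (a ⊛ b)
·-⊛ c a b = coeffwise λ n → trans (sumTo-cong n λ k _ → ℤₚ.*-assoc c (a k) _) (sumTo-*ˡ n c _)

⊕-identityʳ : ∀ a → a ⊕ zeroS ≈ a
⊕-identityʳ a = coeffwise λ n → ℤₚ.+-identityʳ (a n)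

⊛-zeroʳ : ∀ a → a ⊛ zeroS ≈ zeroS
⊛-zeroʳ a = coeffwise λ n → sumTo-zero n λ k _ → ℤₚ.*-zeroʳ (a k)

⊛-annihilateʳ : ∀ a {b} → b ≈ zeroS → a ⊛ b ≈ zeroS
⊛-annihilateʳ a b≈0 = ≈-trans (⊛-congˡ a b≈0) (⊛-zeroʳ a)

⊛-assoc : ∀ a b c → (a ⊛ b) ⊛ c ≈ a ⊛ (b ⊛ c)
⊛-assoc a b c = coeffwise λ n → begin
  sumTo n (λ k → sumTo k (λ i → a i * b (k ∸ i)) * c (n ∸ k))
    ≡⟨ sumTo-cong n (λ k _ → sym (sumTo-*ʳ k (c (n ∸ k)) _)) ⟩
  sumTo n (λ k → sumTo k (λ i → a i * b (k ∸ i) * c (n ∸ k)))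
    ≡⟨ sumTo-cong n (λ k _ → sumTo-cong k λ i i≤k → cong (λ m → a i * b (k ∸ i) * c m) (split n k i i≤k)) ⟩
  sumTo n (λ k → sumTo k (λ i → a i * b (k ∸ i) * c (n ∸ i ∸ (k ∸ i))))
    ≡⟨ sumTo-triangle n (λ i j → a i * b j * c (n ∸ i ∸ j)) ⟩
  sumTo n (λ i → sumTo (n ∸ i) (λ j → a i * b j * c (n ∸ i ∸ j)))
    ≡⟨ sumTo-cong n (λ i _ → trans (sumTo-cong (n ∸ i) λ j _ → ℤₚ.*-assoc (a i) _ _) (sumTo-*ˡ (n ∸ i) (a i) _)) ⟩
  sumTo n (λ i → a i * sumTo (n ∸ i) (λ j → b j * c (n ∸ i ∸ j))) ∎
  where
  open ≡-Reasoning
  split : ∀ n k i → i ≤ k → n ∸ k ≡ n ∸ i ∸ (k ∸ i)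
  split n k i i≤k = trans (cong (n ∸_) (sym (ℕₚ.m+[n∸m]≡n i≤k))) (sym (ℕₚ.∸-+-assoc n i (k ∸ i)))

⊛-identityˡ : ∀ a → oneS ⊛ a ≈ a
⊛-identityˡ a = coeffwise λ where
  zero    → ℤₚ.*-identityˡ (a 0)
  (suc n) → trans (sumTo-shift n _)
    (trans (cong₂ _+_ (ℤₚ.*-identityˡ (a (suc n))) (sumTo-zero n λ _ _ → refl)) (ℤₚ.+-identityʳ _))

⊛-identityʳ : ∀ a → a ⊛ oneS ≈ a
⊛-identityʳ a = ≈-trans (⊛-comm a oneS) (⊛-identityˡ a)

⊕-isAbelianGroup : IsAbelianGroup _≈_ _⊕_ zeroS ⊝_
⊕-isAbelianGroup = record
  { isGroup = record
    { isMonoid = record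
      { isSemigroup = record
        { isMagma = record
          { isEquivalence = record { refl = ≈-refl ; sym = ≈-sym ; trans = ≈-trans }
          ; ∙-cong = ⊕-cong
          }
        ; assoc = λ a b c → coeffwise λ n → ℤₚ.+-assoc (a n) (b n) (c n)
        }
      ; identity = (λ a → coeffwise λ n → ℤₚ.+-identityˡ (a n)) , (λ a → coeffwise λ n → ℤₚ.+-identityʳ (a n))
      }
    ; inverse = (λ a → coeffwise λ n → ℤₚ.+-inverseˡ (a n)) , (λ a → coeffwise λ n → ℤₚ.+-inverseʳ (a n))
    ; ⁻¹-cong = ⊝-cong
    }
  ; comm = λ a b → coeffwise λ n → ℤₚ.+-comm (a n) (b n)
  }

seriesRing : CommutativeRing 0ℓ 0ℓ
seriesRing = record
  { Carrier = Series ; _≈_ = _≈_ ; _+_ = _⊕_ ; _*_ = _⊛_ ; -_ = ⊝_ ; 0# = zeroS ; 1# = oneS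
  ; isCommutativeRing = record
    { isRing = record
      { +-isAbelianGroup = ⊕-isAbelianGroup
      ; *-cong = ⊛-cong
      ; *-assoc = ⊛-assoc
      ; *-identity = ⊛-identityˡ , ⊛-identityʳ
      ; distrib = ⊛-distribˡ , ⊛-distribʳ
      }
    ; *-comm = ⊛-comm
    }
  }

module ≈-Reasoning = SetoidReasoning (CommutativeRing.setoid seriesRing)

constS : ℤ → Series
constS c = c · oneS

constS-⊛ : ∀ c a → constS c ⊛ a ≈ c · a
constS-⊛ c a = ≈-trans (·-⊛ c oneS a) (coeffwise λ n → cong (c *_) (coeff (⊛-identityˡ a) n))

constS-1 : constS 1ℤ ≈ oneS
constS-1 = coeffwise λ n → ℤₚ.*-identityˡ (oneS n)

constS-+ : ∀ c d → constS (c + d) ≈ constS c ⊕ constS d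
constS-+ c d = coeffwise λ n → ℤₚ.*-distribʳ-+ (oneS n) c d

constS-* : ∀ c d → constS (c * d) ≈ constS c ⊛ constS d
constS-* c d = ≈-trans (coeffwise λ n → ℤₚ.*-assoc c d (oneS n)) (≈-sym (constS-⊛ c (constS d)))

constS-homomorphism : ℤ.+-*-rawRing ACR.-Raw-AlmostCommutative⟶ ACR.fromCommutativeRing seriesRing
constS-homomorphism = record
  { ⟦_⟧    = constS
  ; +-homo = constS-+
  ; *-homo = constS-*
  ; -‿homo = λ c → coeffwise λ n → sym (ℤₚ.neg-distribˡ-* c (oneS n))
  ; 0-homo = coeffwise λ _ → refl
  ; 1-homo = constS-1
  }

constS-≟ : ∀ c d → Maybe (constS c ≈ constS d)
constS-≟ c d with c ℤ.≟ d
... | yes refl = just ≈-refl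
... | no _     = nothing

open Algebra.Solver.Ring ℤ.+-*-rawRing (ACR.fromCommutativeRing seriesRing) constS-homomorphism constS-≟
  using (solve; _:=_; _:+_; _:*_; _:-_; :-_; con) public

constS-neg-⊛ : ∀ σ a → constS (-1ℤ * σ) ⊛ a ≈ ⊝ (constS σ ⊛ a)
constS-neg-⊛ σ a = ≈-trans (⊛-congʳ a (constS-* -1ℤ σ))
  (solve 2 (λ x a → (con -1ℤ :* x) :* a := :- (x :* a)) ≈-refl (constS σ) a)

sumS : ℕ → (ℕ → Series) → Series
sumS M h n = sumTo M (λ j → h j n)

sumS-cong : ∀ M {h h′} → (∀ j → j ≤ M → h j ≈ h′ j) → sumS M h ≈ sumS M h′
sumS-cong M h≈h′ = coeffwise λ n → sumTo-cong M λ j j≤M → coeff (h≈h′ j j≤M) n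

sumS-⊕ : ∀ M h h′ → sumS M (λ j → h j ⊕ h′ j) ≈ sumS M h ⊕ sumS M h′
sumS-⊕ M h h′ = coeffwise λ n → sumTo-+ M (λ j → h j n) (λ j → h′ j n)

sumS-⊛ : ∀ M x h → sumS M (λ j → x ⊛ h j) ≈ x ⊛ sumS M h
sumS-⊛ zero    x h = ≈-refl
sumS-⊛ (suc M) x h = ≈-trans (⊕-congʳ (x ⊛ h (suc M)) (sumS-⊛ M x h)) (≈-sym (⊛-distribˡ x (sumS M h) (h (suc M))))

sumS-shift : ∀ M h → sumS (suc M) h ≈ h 0 ⊕ sumS M (λ j → h (suc j))
sumS-shift M h = coeffwise λ n → sumTo-shift M (λ j → h j n)

sumS-⊝⊛ : ∀ M x h → sumS M (λ j → ⊝ (x ⊛ h j)) ≈ ⊝ (x ⊛ sumS M h)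
sumS-⊝⊛ M x h = ≈-trans (coeffwise λ n → sumTo-neg M (λ j → (x ⊛ h j) n)) (⊝-cong (sumS-⊛ M x h))

sumS-extend : ∀ M h → h (suc M) ≈ zeroS → sumS (suc M) h ≈ sumS M h
sumS-extend M h h≈0 = ≈-trans (⊕-congˡ (sumS M h) h≈0) (⊕-identityʳ (sumS M h))

-- Monomials, agreement up to q^M, congruences

q^_ : ℕ → Series
(q^ e) n with n ℕ.≟ e
... | yes _ = 1ℤ
... | no  _ = 0ℤ

q^-≢ : ∀ e {n} → n ≢ e → (q^ e) n ≡ 0ℤ
q^-≢ e {n} n≢e with n ℕ.≟ e
... | yes n≡e = ⊥-elim (n≢e n≡e)
... | no  _   = refl

q^-≡ : ∀ e → (q^ e) e ≡ 1ℤ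
q^-≡ e with e ℕ.≟ e
... | yes _   = refl
... | no  e≢e = ⊥-elim (e≢e refl)

q^-< : ∀ e {n} → n < e → (q^ e) n ≡ 0ℤ
q^-< e n<e = q^-≢ e λ { refl → ℕₚ.<-irrefl refl n<e }

q^0 : q^ 0 ≈ oneS
q^0 = coeffwise λ where
  zero    → refl
  (suc n) → refl

q^⊛-< : ∀ e a {n} → n < e → (q^ e ⊛ a) n ≡ 0ℤ
q^⊛-< e a {n} n<e = sumTo-zero n λ k k≤n →
  cong (_* a (n ∸ k)) (q^-< e (ℕₚ.≤-<-trans k≤n n<e))

q^⊛-+ : ∀ e a m → (q^ e ⊛ a) (e ℕ.+ m) ≡ a m
q^⊛-+ e a m = begin
  sumTo (e ℕ.+ m) (λ k → (q^ e) k * a (e ℕ.+ m ∸ k))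
    ≡⟨ sumTo-single (e ℕ.+ m) e (ℕₚ.m≤m+n e m) (λ k k≢e → cong (_* a (e ℕ.+ m ∸ k)) (q^-≢ e k≢e)) ⟩
  (q^ e) e * a (e ℕ.+ m ∸ e)
    ≡⟨ cong₂ _*_ (q^-≡ e) (cong a (ℕₚ.m+n∸m≡n e m)) ⟩
  1ℤ * a m
    ≡⟨ ℤₚ.*-identityˡ (a m) ⟩
  a m ∎
  where open ≡-Reasoning

below-or-above : ∀ e n → n < e ⊎ Σ ℕ (λ m → n ≡ e ℕ.+ m)
below-or-above e n with n ℕ.<? e
... | yes n<e = inj₁ n<e
... | no  n≮e = inj₂ (n ∸ e , sym (ℕₚ.m+[n∸m]≡n (ℕₚ.≮⇒≥ n≮e)))

q^-+ : ∀ d e → q^ d ⊛ q^ e ≈ q^ (d ℕ.+ e)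
q^-+ d e = coeffwise coefficient
  where
  coefficient : ∀ n → (q^ d ⊛ q^ e) n ≡ (q^ (d ℕ.+ e)) n
  coefficient n with below-or-above d n
  ... | inj₁ n<d = trans (q^⊛-< d (q^ e) n<d) (sym (q^-< (d ℕ.+ e) (ℕₚ.<-≤-trans n<d (ℕₚ.m≤m+n d e))))
  ... | inj₂ (m , refl) = trans (q^⊛-+ d (q^ e) m) (shifted m (m ℕ.≟ e))
    where
    shifted : ∀ m → Dec (m ≡ e) → (q^ e) m ≡ (q^ (d ℕ.+ e)) (d ℕ.+ m)
    shifted m (yes refl) = trans (q^-≡ m) (sym (q^-≡ (d ℕ.+ m)))
    shifted m (no m≢e)   = trans (q^-≢ e m≢e) (sym (q^-≢ (d ℕ.+ e) (m≢e ∘ ℕₚ.+-cancelˡ-≡ d m e)))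

infix 4 _≈[_]_
_≈[_]_ : Series → ℕ → Series → Set
a ≈[ M ] b = ∀ n → n < M → a n ≡ b n

≈⇒≈[] : ∀ {a b} M → a ≈ b → a ≈[ M ] b
≈⇒≈[] M a≈b n _ = coeff a≈b n

≈[]-refl : ∀ {a} M → a ≈[ M ] a
≈[]-refl M n _ = refl

≈[]-sym : ∀ {a b M} → a ≈[ M ] b → b ≈[ M ] a
≈[]-sym a≈b n n<M = sym (a≈b n n<M)

≈[]-trans : ∀ {a b c M} → a ≈[ M ] b → b ≈[ M ] c → a ≈[ M ] c
≈[]-trans a≈b b≈c n n<M = trans (a≈b n n<M) (b≈c n n<M)

≈[]-weaken : ∀ {a b M M′} → M′ ≤ M → a ≈[ M ] b → a ≈[ M′ ] b
≈[]-weaken M′≤M a≈b n n<M′ = a≈b n (ℕₚ.<-≤-trans n<M′ M′≤M)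

⊕-cong[] : ∀ {a a′ b b′ M} → a ≈[ M ] a′ → b ≈[ M ] b′ → a ⊕ b ≈[ M ] a′ ⊕ b′
⊕-cong[] a≈a′ b≈b′ n n<M = cong₂ _+_ (a≈a′ n n<M) (b≈b′ n n<M)

⊛-cong[] : ∀ {a a′ b b′ M} → a ≈[ M ] a′ → b ≈[ M ] b′ → a ⊛ b ≈[ M ] a′ ⊛ b′
⊛-cong[] a≈a′ b≈b′ n n<M = sumTo-cong n λ k k≤n →
  cong₂ _*_ (a≈a′ k (ℕₚ.≤-<-trans k≤n n<M)) (b≈b′ (n ∸ k) (ℕₚ.≤-<-trans (ℕₚ.m∸n≤m n k) n<M))

⊛-one[] : ∀ {a b M} → a ≈[ M ] oneS → b ≈[ M ] oneS → a ⊛ b ≈[ M ] oneS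
⊛-one[] {M = M} a≈1 b≈1 = ≈[]-trans (⊛-cong[] a≈1 b≈1) (≈⇒≈[] M (⊛-identityˡ oneS))

q^⊛-cong[] : ∀ e {a b M} → a ≈[ M ] b → q^ e ⊛ a ≈[ e ℕ.+ M ] q^ e ⊛ b
q^⊛-cong[] e {a} {b} a≈b n n<e+M with below-or-above e n
... | inj₁ n<e = trans (q^⊛-< e a n<e) (sym (q^⊛-< e b n<e))
... | inj₂ (m , refl) =
  trans (q^⊛-+ e a m) (trans (a≈b m (ℕₚ.+-cancelˡ-< e m _ n<e+M)) (sym (q^⊛-+ e b m)))

infix 4 _≡[mod_]_
record _≡[mod_]_ (a : Series) (m : ℤ) (b : Series) : Set where
  constructor congruent
  field
    quotient   : Series
    difference : a ≈ b ⊕ constS m ⊛ quotient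
open _≡[mod_]_ public

module _ where
  open ≈-Reasoning

  ≈⇒≡[mod] : ∀ {a b} m → a ≈ b → a ≡[mod m ] b
  ≈⇒≡[mod] {a} {b} m a≈b = congruent zeroS (begin
    a                          ≈⟨ a≈b ⟩
    b                          ≈⟨ ⊕-identityʳ b ⟨
    b ⊕ zeroS                  ≈⟨ ⊕-congˡ b (⊛-zeroʳ (constS m)) ⟨
    b ⊕ constS m ⊛ zeroS       ∎)

  ≡[mod]-sym : ∀ {a b m} → a ≡[mod m ] b → b ≡[mod m ] a
  ≡[mod]-sym {a} {b} {m} (congruent q a≈b+mq) = congruent (⊝ q) (begin
    b                                    ≈⟨ solve 3 (λ b m q → b := (b :+ m :* q) :+ m :* (:- q)) ≈-refl b (constS m) q ⟩
    (b ⊕ constS m ⊛ q) ⊕ constS m ⊛ ⊝ q  ≈⟨ ⊕-congʳ (constS m ⊛ ⊝ q) a≈b+mq ⟨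
    a ⊕ constS m ⊛ ⊝ q                   ∎)

  ≡[mod]-trans : ∀ {a b c m} → a ≡[mod m ] b → b ≡[mod m ] c → a ≡[mod m ] c
  ≡[mod]-trans {a} {b} {c} {m} (congruent q a≈b+mq) (congruent r b≈c+mr) = congruent (q ⊕ r) (begin
    a                                    ≈⟨ a≈b+mq ⟩
    b ⊕ constS m ⊛ q                     ≈⟨ ⊕-congʳ (constS m ⊛ q) b≈c+mr ⟩
    (c ⊕ constS m ⊛ r) ⊕ constS m ⊛ q    ≈⟨ solve 4 (λ c m q r → (c :+ m :* r) :+ m :* q := c :+ m :* (q :+ r)) ≈-refl c (constS m) q r ⟩
    c ⊕ constS m ⊛ (q ⊕ r)               ∎)

  ⊕-cong-mod : ∀ {a a′ b b′ m} → a ≡[mod m ] a′ → b ≡[mod m ] b′ → a ⊕ b ≡[mod m ] a′ ⊕ b′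
  ⊕-cong-mod {a} {a′} {b} {b′} {m} (congruent q a≈a′+mq) (congruent r b≈b′+mr) = congruent (q ⊕ r) (begin
    a ⊕ b                                            ≈⟨ ⊕-cong a≈a′+mq b≈b′+mr ⟩
    (a′ ⊕ constS m ⊛ q) ⊕ (b′ ⊕ constS m ⊛ r)
      ≈⟨ solve 5 (λ a b m q r → (a :+ m :* q) :+ (b :+ m :* r) := (a :+ b) :+ m :* (q :+ r)) ≈-refl a′ b′ (constS m) q r ⟩
    (a′ ⊕ b′) ⊕ constS m ⊛ (q ⊕ r)                   ∎)

  ⊛-cong-mod : ∀ {a a′ b b′ m} → a ≡[mod m ] a′ → b ≡[mod m ] b′ → a ⊛ b ≡[mod m ] a′ ⊛ b′
  ⊛-cong-mod {a} {a′} {b} {b′} {m} (congruent q a≈a′+mq) (congruent r b≈b′+mr) = congruent (q ⊛ b ⊕ a′ ⊛ r) (begin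
    a ⊛ b                                            ≈⟨ ⊛-congʳ b a≈a′+mq ⟩
    (a′ ⊕ constS m ⊛ q) ⊛ b                          ≈⟨ solve 4 (λ a b m q → (a :+ m :* q) :* b := a :* b :+ m :* (q :* b)) ≈-refl a′ b (constS m) q ⟩
    a′ ⊛ b ⊕ constS m ⊛ (q ⊛ b)                      ≈⟨ ⊕-congʳ (constS m ⊛ (q ⊛ b)) (⊛-congˡ a′ b≈b′+mr) ⟩
    a′ ⊛ (b′ ⊕ constS m ⊛ r) ⊕ constS m ⊛ (q ⊛ b)
      ≈⟨ solve 6 (λ a b b′ m q r → a :* (b′ :+ m :* r) :+ m :* (q :* b) := a :* b′ :+ m :* (q :* b :+ a :* r)) ≈-refl
                 a′ b b′ (constS m) q r ⟩
    a′ ⊛ b′ ⊕ constS m ⊛ (q ⊛ b ⊕ a′ ⊛ r)            ∎)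

  constS-⊛-mono-mod : ∀ {a b m} c → a ≡[mod m ] b → constS c ⊛ a ≡[mod c * m ] constS c ⊛ b
  constS-⊛-mono-mod {a} {b} {m} c (congruent q a≈b+mq) = congruent q (begin
    constS c ⊛ a                                     ≈⟨ ⊛-congˡ (constS c) a≈b+mq ⟩
    constS c ⊛ (b ⊕ constS m ⊛ q)                    ≈⟨ solve 4 (λ C b M q → C :* (b :+ M :* q) := C :* b :+ (C :* M) :* q) ≈-refl (constS c) b (constS m) q ⟩
    constS c ⊛ b ⊕ (constS c ⊛ constS m) ⊛ q         ≈⟨ ⊕-congˡ (constS c ⊛ b) (⊛-congʳ q (constS-* c m)) ⟨
    constS c ⊛ b ⊕ constS (c * m) ⊛ q                ∎)

  multiple≡[mod]0 : ∀ m a → constS m ⊛ a ≡[mod m ] zeroS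
  multiple≡[mod]0 m a = congruent a (begin
    constS m ⊛ a            ≈⟨ solve 2 (λ m a → m :* a := con 0ℤ :+ m :* a) ≈-refl (constS m) a ⟩
    constS 0ℤ ⊕ constS m ⊛ a ≈⟨ ⊕-congʳ (constS m ⊛ a) (coeffwise λ n → ℤₚ.*-zeroˡ (oneS n)) ⟩
    zeroS ⊕ constS m ⊛ a    ∎)

  constS-cong-mod : ∀ {c d m} → m ∣ℤ c - d → constS c ≡[mod m ] constS d
  constS-cong-mod {c} {d} {m} (divides k c-d≡km) = congruent (constS k) (begin
    constS c                     ≈⟨ coeffwise (λ n → cong (_* oneS n) c≡d+mk) ⟩
    constS (d + m * k)           ≈⟨ constS-+ d (m * k) ⟩
    constS d ⊕ constS (m * k)    ≈⟨ ⊕-congˡ (constS d) (constS-* m k) ⟩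
    constS d ⊕ constS m ⊛ constS k ∎)
    where
    c≡d+mk : c ≡ d + m * k
    c≡d+mk = trans (shift c d) (cong (λ x → d + x) (trans c-d≡km (ℤₚ.*-comm k m)))
      where shift : ∀ c d → c ≡ d + (c - d)
            shift = solve-∀

  constS-⊛-cong-mod : ∀ {m} c d a → m ∣ℤ c - d → constS c ⊛ a ≡[mod m ] constS d ⊛ a
  constS-⊛-cong-mod {m} c d a m∣c-d = ⊛-cong-mod (constS-cong-mod {c} {d} m∣c-d) (≈⇒≡[mod] m (≈-refl {a}))

≡[mod]-setoid : ℤ → Setoid 0ℓ 0ℓ
≡[mod]-setoid m = record
  { Carrier = Series
  ; _≈_ = _≡[mod m ]_
  ; isEquivalence = record { refl = ≈⇒≡[mod] m ≈-refl ; sym = ≡[mod]-sym ; trans = ≡[mod]-trans }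
  }

∣⇒≡[mod] : ∀ {a b m} → (∀ n → m ∣ℤ a n - b n) → a ≡[mod m ] b
∣⇒≡[mod] {a} {b} {m} m∣a-b = congruent q (coeffwise λ n → begin
  a n                         ≡⟨ shift (a n) (b n) ⟩
  b n + (a n - b n)           ≡⟨ cong (λ x → b n + x) (ℤ∣._∣_.equality (m∣a-b n)) ⟩
  b n + q n * m               ≡⟨ cong (λ x → b n + x) (trans (ℤₚ.*-comm (q n) m) (sym (coeff (constS-⊛ m q) n))) ⟩
  b n + (constS m ⊛ q) n      ∎)
  where
  open ≡-Reasoning
  q : Series
  q n = ℤ∣._∣_.quotient (m∣a-b n)
  shift : ∀ x y → x ≡ y + (x - y)
  shift = solve-∀

module ≡[mod]-Reasoning (m : ℤ) = SetoidReasoning (≡[mod]-setoid m)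

≡[mod]⇒∣ : ∀ {a b m} → a ≡[mod m ] b → ∀ n → m ∣ℤ a n - b n
≡[mod]⇒∣ {a} {b} {m} (congruent q a≈b+mq) n = divides (q n) (begin
  a n - b n                      ≡⟨ cong (_- b n) (coeff a≈b+mq n) ⟩
  b n + (constS m ⊛ q) n - b n   ≡⟨ cancel (b n) _ ⟩
  (constS m ⊛ q) n               ≡⟨ coeff (constS-⊛ m q) n ⟩
  m * q n                        ≡⟨ ℤₚ.*-comm m (q n) ⟩
  q n * m                        ∎)
  where
  open ≡-Reasoning
  cancel : ∀ x y → x + y - x ≡ y
  cancel = solve-∀

-- Infinite products

Family : Set
Family = ℕ → Series

∏ : Family → Series
∏ F n = prodTo n F n

-- Factor i is 1 + O(q^i), so the coefficient of q^n of the infinite product only involves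
-- the factors i ≤ n, as the truncation in ∏ presumes.
Convergent : Family → Set
Convergent F = ∀ i → 1 ≤ i → F i ≈[ i ] oneS

prodTo-cong : ∀ N {F G} → (∀ i → 1 ≤ i → F i ≈ G i) → prodTo N F ≈ prodTo N G
prodTo-cong zero    F≈G = ≈-refl
prodTo-cong (suc N) F≈G = ⊛-cong (prodTo-cong N F≈G) (F≈G (suc N) (s≤s z≤n))

∏-cong : ∀ {F G} → (∀ i → 1 ≤ i → F i ≈ G i) → ∏ F ≈ ∏ G
∏-cong F≈G = coeffwise λ n → coeff (prodTo-cong n F≈G) n

prodTo-stable : ∀ j N F M → j ≤ N → (∀ i → j < i → i ≤ N → F i ≈[ M ] oneS) →
                prodTo N F ≈[ M ] prodTo j F
prodTo-stable j N F M j≤N F≈1 with j ℕ.≟ N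
prodTo-stable j .j F M j≤N F≈1 | yes refl = ≈[]-refl M
prodTo-stable j (suc N) F M j≤1+N F≈1 | no j≢1+N =
  ≈[]-trans (⊛-cong[] (prodTo-stable j N F M j≤N λ i j<i i≤N → F≈1 i j<i (ℕₚ.m≤n⇒m≤1+n i≤N))
                      (F≈1 (suc N) (s≤s j≤N) ℕₚ.≤-refl))
            (≈⇒≈[] M (⊛-identityʳ (prodTo j F)))
  where j≤N = ℕₚ.≤-pred (ℕₚ.≤∧≢⇒< j≤1+N j≢1+N)
prodTo-stable .zero zero F M z≤n F≈1 | no 0≢0 = ⊥-elim (0≢0 refl)

∏-prodTo : ∀ {F} → Convergent F → ∀ {n} N → n ≤ N → ∏ F n ≡ prodTo N F n
∏-prodTo {F} conv {n} N n≤N = sym (prodTo-stable n N F (suc n) n≤N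
  (λ i n<i _ → ≈[]-weaken n<i (conv i (ℕₚ.<-≤-trans (s≤s z≤n) n<i))) n ℕₚ.≤-refl)

∏≈[]prodTo : ∀ {F} → Convergent F → ∀ N → ∏ F ≈[ suc N ] prodTo N F
∏≈[]prodTo conv N n n<1+N = ∏-prodTo conv N (ℕₚ.≤-pred n<1+N)

prodTo-⊛ : ∀ N F G → prodTo N F ⊛ prodTo N G ≈ prodTo N (λ i → F i ⊛ G i)
prodTo-⊛ zero    F G = ⊛-identityˡ oneS
prodTo-⊛ (suc N) F G = ≈-trans
  (solve 4 (λ a b c d → (a :* c) :* (b :* d) := (a :* b) :* (c :* d)) ≈-refl
           (prodTo N F) (prodTo N G) (F (suc N)) (G (suc N)))
  (⊛-congʳ (F (suc N) ⊛ G (suc N)) (prodTo-⊛ N F G))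

∏-⊛ : ∀ {F G} → Convergent F → Convergent G → ∏ F ⊛ ∏ G ≈ ∏ (λ i → F i ⊛ G i)
∏-⊛ {F} {G} convF convG = coeffwise λ n →
  trans (⊛-cong[] (∏≈[]prodTo convF n) (∏≈[]prodTo convG n) n ℕₚ.≤-refl) (coeff (prodTo-⊛ n F G) n)

Convergent-⊛ : ∀ {F G} → Convergent F → Convergent G → Convergent (λ i → F i ⊛ G i)
Convergent-⊛ convF convG i 1≤i = ⊛-one[] (convF i 1≤i) (convG i 1≤i)

∏-one : ∀ {F} → (∀ i → 1 ≤ i → F i ≈ oneS) → ∏ F ≈ oneS
∏-one {F} F≈1 = coeffwise λ n → trans (coeff (prodTo-cong n F≈1) n) (coeff (prodTo-one n) n)
  where
  prodTo-one : ∀ N → prodTo N (λ _ → oneS) ≈ oneS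
  prodTo-one zero    = ≈-refl
  prodTo-one (suc N) = ≈-trans (⊛-identityʳ _) (prodTo-one N)

block : ℕ → ℕ → Family → Series
block a zero    G = oneS
block a (suc l) G = block a l G ⊛ G (a ℕ.+ suc l)

blocks : ℕ → Family → Family
blocks L G zero    = oneS
blocks L G (suc n) = block (L ℕ.* n) L G

prodTo-+ : ∀ a l G → prodTo (a ℕ.+ l) G ≈ prodTo a G ⊛ block a l G
prodTo-+ a zero G rewrite ℕₚ.+-identityʳ a = ≈-sym (⊛-identityʳ (prodTo a G))
prodTo-+ a (suc l) G rewrite ℕₚ.+-suc a l =
  ≈-trans (⊛-congʳ (G (suc (a ℕ.+ l))) (prodTo-+ a l G)) (⊛-assoc (prodTo a G) (block a l G) (G (suc (a ℕ.+ l))))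

prodTo-blocks : ∀ L G N → prodTo N (blocks L G) ≈ prodTo (L ℕ.* N) G
prodTo-blocks L G zero rewrite ℕₚ.*-zeroʳ L = ≈-refl
prodTo-blocks L G (suc N) =
  ≈-trans (⊛-congʳ (block (L ℕ.* N) L G) (prodTo-blocks L G N))
          (≈-trans (≈-sym (prodTo-+ (L ℕ.* N) L G))
                   (coeffwise λ n → cong (λ m → prodTo m G n) (trans (ℕₚ.+-comm (L ℕ.* N) L) (sym (ℕₚ.*-suc L N)))))

∏-blocks : ∀ L .{{_ : ℕ.NonZero L}} {G} → Convergent G → ∏ (blocks L G) ≈ ∏ G
∏-blocks L {G} conv = coeffwise λ n →
  trans (coeff (prodTo-blocks L G n) n) (sym (∏-prodTo conv (L ℕ.* n) (ℕₚ.m≤n*m n L)))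

Convergent-blocks : ∀ L .{{_ : ℕ.NonZero L}} {G} → Convergent G → Convergent (blocks L G)
Convergent-blocks L {G} conv (suc n) _ = block≈1 L ℕₚ.≤-refl
  where
  block≈1 : ∀ l → l ≤ L → block (L ℕ.* n) l G ≈[ suc n ] oneS
  block≈1 zero    _   = ≈[]-refl (suc n)
  block≈1 (suc l) l<L = ⊛-one[] (block≈1 l (ℕₚ.<⇒≤ l<L))
    (≈[]-weaken n<Ln+1+l (conv (L ℕ.* n ℕ.+ suc l) (ℕₚ.≤-trans (s≤s z≤n) (ℕₚ.m≤n+m (suc l) (L ℕ.* n)))))
    where
    n<Ln+1+l : suc n ≤ L ℕ.* n ℕ.+ suc l
    n<Ln+1+l = ℕₚ.≤-trans (s≤s (ℕₚ.m≤n*m n L))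
      (ℕₚ.≤-trans (ℕₚ.+-monoˡ-≤ (L ℕ.* n) (s≤s (z≤n {l}))) (ℕₚ.≤-reflexive (ℕₚ.+-comm (suc l) (L ℕ.* n))))

oneMinusQ^-≈ : ∀ {d} → 1 ≤ d → oneMinusQ^ d ≈ oneS ⊕ ⊝ q^ d
oneMinusQ^-≈ {d} 1≤d = coeffwise λ where
    zero    → cong (λ z → 1ℤ + - z) (sym (q^-< d 1≤d))
    (suc n) → trans (negated n) (sym (ℤₚ.+-identityˡ _))
  where
  negated : ∀ n → oneMinusQ^ d (suc n) ≡ - (q^ d) (suc n)
  negated n with suc n ℕ.≟ d
  ... | yes _ = refl
  ... | no  _ = refl

oneMinusQ^-cong : ∀ {d e} → d ≡ e → oneMinusQ^ d ≈ oneMinusQ^ e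
oneMinusQ^-cong = ≡⇒≈ ∘ cong oneMinusQ^

oneMinusQ^≈[] : ∀ {d} → 1 ≤ d → oneMinusQ^ d ≈[ d ] oneS
oneMinusQ^≈[] {d} 1≤d n n<d =
  trans (coeff (oneMinusQ^-≈ 1≤d) n) (trans (cong (λ z → oneS n + - z) (q^-< d n<d)) (ℤₚ.+-identityʳ (oneS n)))

geomQ^≈[] : ∀ d → geomQ^ d ≈[ d ] oneS
geomQ^≈[] d zero    _ with d ℕ∣.∣? 0
... | yes _ = refl
... | no  d∤0 = ⊥-elim (d∤0 (d ℕ∣.∣0))
geomQ^≈[] d (suc n) 1+n<d with d ℕ∣.∣? suc n
... | yes d∣1+n = ⊥-elim (ℕₚ.<-irrefl refl (ℕₚ.<-≤-trans 1+n<d (ℕ∣.∣⇒≤ d∣1+n)))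
... | no  _     = refl

geomQ^-+ : ∀ d m → geomQ^ d (d ℕ.+ m) ≡ geomQ^ d m
geomQ^-+ d m with d ℕ∣.∣? (d ℕ.+ m) | d ℕ∣.∣? m
... | yes _     | yes _   = refl
... | no  _     | no  _   = refl
... | yes d∣d+m | no  d∤m = ⊥-elim (d∤m (ℕ∣.∣m+n∣m⇒∣n d∣d+m ℕ∣.∣-refl))
... | no  d∤d+m | yes d∣m = ⊥-elim (d∤d+m (ℕ∣.∣m∣n⇒∣m+n ℕ∣.∣-refl d∣m))

geomQ^⊛oneMinusQ^ : ∀ {d} → 1 ≤ d → geomQ^ d ⊛ oneMinusQ^ d ≈ oneS
geomQ^⊛oneMinusQ^ {d} 1≤d = begin
  geomQ^ d ⊛ oneMinusQ^ d                   ≈⟨ ⊛-congˡ (geomQ^ d) (oneMinusQ^-≈ 1≤d) ⟩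
  geomQ^ d ⊛ (oneS ⊕ ⊝ q^ d)                ≈⟨ solve 3 (λ g o x → g :* (o :- x) := g :* o :- x :* g) ≈-refl (geomQ^ d) oneS (q^ d) ⟩
  geomQ^ d ⊛ oneS ⊕ ⊝ (q^ d ⊛ geomQ^ d)     ≈⟨ ⊕-congʳ (⊝ (q^ d ⊛ geomQ^ d)) (⊛-identityʳ (geomQ^ d)) ⟩
  geomQ^ d ⊕ ⊝ (q^ d ⊛ geomQ^ d)            ≈⟨ telescope ⟩
  oneS ∎
  where
  open ≈-Reasoning
  telescope : geomQ^ d ⊕ ⊝ (q^ d ⊛ geomQ^ d) ≈ oneS
  telescope = coeffwise coefficient
    where
    coefficient : ∀ n → geomQ^ d n + - (q^ d ⊛ geomQ^ d) n ≡ oneS n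
    coefficient n with below-or-above d n
    ... | inj₁ n<d = trans (cong (λ z → geomQ^ d n + - z) (q^⊛-< d (geomQ^ d) n<d))
                           (trans (ℤₚ.+-identityʳ (geomQ^ d n)) (geomQ^≈[] d n n<d))
    ... | inj₂ (m , refl) = trans (cong₂ (λ x y → x + - y) (geomQ^-+ d m) (q^⊛-+ d (geomQ^ d) m))
                                  (trans (ℤₚ.+-inverseʳ (geomQ^ d m)) (sym (oneS-+ 1≤d)))
      where
      oneS-+ : ∀ {e} → 1 ≤ e → oneS (e ℕ.+ m) ≡ 0ℤ
      oneS-+ (s≤s _) = refl

f-factor : ℕ → Family
f-factor k i = oneMinusQ^ (k ℕ.* i)

Convergent-f : ∀ k .{{_ : ℕ.NonZero k}} → Convergent (f-factor k)
Convergent-f k i 1≤i = ≈[]-weaken (ℕₚ.m≤n*m i k) (oneMinusQ^≈[] (ℕₚ.*-mono-≤ (ℕ.>-nonZero⁻¹ k) 1≤i))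

Convergent-invf : ∀ k .{{_ : ℕ.NonZero k}} → Convergent (λ i → geomQ^ (k ℕ.* i))
Convergent-invf k i 1≤i = ≈[]-weaken (ℕₚ.m≤n*m i k) (geomQ^≈[] (k ℕ.* i))

f⊛invf : ∀ k .{{_ : ℕ.NonZero k}} → f k ⊛ invf k ≈ oneS
f⊛invf k = ≈-trans (∏-⊛ (Convergent-f k) (Convergent-invf k)) (∏-one λ i 1≤i →
  ≈-trans (⊛-comm (oneMinusQ^ (k ℕ.* i)) (geomQ^ (k ℕ.* i))) (geomQ^⊛oneMinusQ^ (ℕₚ.*-mono-≤ (ℕ.>-nonZero⁻¹ k) 1≤i)))

-- Dilation and dissection

-- dilate s a = a(q^s)
dilate : ℕ → Series → Series
dilate s a n with s ℕ∣.∣? n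
... | yes s∣n = a (ℕ∣._∣_.quotient s∣n)
... | no  _   = 0ℤ

-- a = Σ_{r < s} q^r ⊛ dilate s (dissect s r a)
dissect : ℕ → ℕ → Series → Series
dissect s r a n = a (s ℕ.* n ℕ.+ r)

dissect-cong : ∀ s r {a b} → a ≈ b → dissect s r a ≈ dissect s r b
dissect-cong s r a≈b = coeffwise λ n → coeff a≈b (s ℕ.* n ℕ.+ r)

dissect-cong-mod : ∀ s r {a b m} → a ≡[mod m ] b → dissect s r a ≡[mod m ] dissect s r b
dissect-cong-mod s r {b = b} {m} (congruent q a≈b+mq) = congruent (dissect s r q) (coeffwise λ n →
  trans (coeff a≈b+mq (s ℕ.* n ℕ.+ r)) (cong (λ x → b (s ℕ.* n ℕ.+ r) + x)
    (trans (coeff (constS-⊛ m q) (s ℕ.* n ℕ.+ r)) (sym (coeff (constS-⊛ m (dissect s r q)) n)))))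

dilate-* : ∀ s .{{_ : ℕ.NonZero s}} a j → dilate s a (s ℕ.* j) ≡ a j
dilate-* s a j with s ℕ∣.∣? (s ℕ.* j)
... | yes (ℕ∣.divides q sj≡qs) = cong a (ℕₚ.*-cancelʳ-≡ q j s (trans (sym sj≡qs) (ℕₚ.*-comm s j)))
... | no  s∤sj                 = ⊥-elim (s∤sj (ℕ∣.m∣m*n j))

dilate-∤ : ∀ s a {n} → ¬ (s ℕ∣.∣ n) → dilate s a n ≡ 0ℤ
dilate-∤ s a {n} s∤n with s ℕ∣.∣? n
... | yes s∣n = ⊥-elim (s∤n s∣n)
... | no  _   = refl

∤*+ : ∀ s m {r} → 0 < r → r < s → ¬ (s ℕ∣.∣ s ℕ.* m ℕ.+ r)
∤*+ s m 0<r r<s s∣sm+r =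
  ℕₚ.<-irrefl refl (ℕₚ.<-≤-trans r<s (ℕ∣.∣⇒≤ {{ℕ.>-nonZero 0<r}} (ℕ∣.∣m+n∣m⇒∣n s∣sm+r (ℕ∣.m∣m*n m))))

sumTo-multiples : ∀ s .{{_ : ℕ.NonZero s}} {g : ℕ → ℤ} → (∀ k → ¬ (s ℕ∣.∣ k) → g k ≡ 0ℤ) →
                  ∀ m {r} → r < s → sumTo (s ℕ.* m ℕ.+ r) g ≡ sumTo m (λ j → g (s ℕ.* j))
sumTo-multiples (suc s₀) g≡0 zero {zero} _ rewrite ℕₚ.*-zeroʳ s₀ = refl
sumTo-multiples s@(suc s₀) {g} g≡0 (suc m) {zero} _ = begin
  sumTo (s ℕ.* suc m ℕ.+ 0) g                   ≡⟨ cong (λ x → sumTo x g) (previous s₀ m) ⟩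
  sumTo (s ℕ.* m ℕ.+ s₀) g + g (suc (s ℕ.* m ℕ.+ s₀))
    ≡⟨ cong₂ _+_ (sumTo-multiples s g≡0 m ℕₚ.≤-refl) (cong g (trans (sym (previous s₀ m)) (ℕₚ.+-identityʳ _))) ⟩
  sumTo (suc m) (λ j → g (s ℕ.* j))            ∎
  where
  open ≡-Reasoning
  previous : ∀ s₀ m → suc s₀ ℕ.* suc m ℕ.+ 0 ≡ suc (suc s₀ ℕ.* m ℕ.+ s₀)
  previous = ℕ-Solver.solve-∀
sumTo-multiples s@(suc _) {g} g≡0 m {suc r} 1+r<s = begin
  sumTo (s ℕ.* m ℕ.+ suc r) g                         ≡⟨ cong (λ x → sumTo x g) (ℕₚ.+-suc (s ℕ.* m) r) ⟩
  sumTo (s ℕ.* m ℕ.+ r) g + g (suc (s ℕ.* m ℕ.+ r))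
    ≡⟨ cong₂ _+_ (sumTo-multiples s g≡0 m (ℕₚ.<-trans (ℕₚ.n<1+n r) 1+r<s))
                 (g≡0 _ (subst (λ x → ¬ (s ℕ∣.∣ x)) (ℕₚ.+-suc (s ℕ.* m) r) (∤*+ s m (s≤s z≤n) 1+r<s))) ⟩
  sumTo m (λ j → g (s ℕ.* j)) + 0ℤ                   ≡⟨ ℤₚ.+-identityʳ _ ⟩
  sumTo m (λ j → g (s ℕ.* j))                         ∎
  where open ≡-Reasoning

dilate⊛-coefficient : ∀ s .{{_ : ℕ.NonZero s}} a b n {r} → r < s →
  (dilate s a ⊛ b) (s ℕ.* n ℕ.+ r) ≡ sumTo n (λ j → a j * b (s ℕ.* (n ∸ j) ℕ.+ r))
dilate⊛-coefficient s a b n {r} r<s =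
  trans (sumTo-multiples s (λ k s∤k → cong (_* b (s ℕ.* n ℕ.+ r ∸ k)) (dilate-∤ s a s∤k)) n r<s)
        (sumTo-cong n λ j j≤n → cong₂ _*_ (dilate-* s a j) (cong b (complement j≤n)))
  where
  complement : ∀ {j} → j ≤ n → s ℕ.* n ℕ.+ r ∸ s ℕ.* j ≡ s ℕ.* (n ∸ j) ℕ.+ r
  complement {j} j≤n = trans (ℕₚ.+-∸-comm r (ℕₚ.*-monoʳ-≤ s j≤n)) (cong (ℕ._+ r) (sym (ℕₚ.*-distribˡ-∸ s n j)))

dissect-dilate-⊛ : ∀ s .{{_ : ℕ.NonZero s}} r a b → r < s → dissect s r (dilate s a ⊛ b) ≈ a ⊛ dissect s r b
dissect-dilate-⊛ s r a b r<s = coeffwise λ n → dilate⊛-coefficient s a b n r<s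

data Residue (s : ℕ) : ℕ → Set where
  multiple    : ∀ m → Residue s (s ℕ.* m)
  nonmultiple : ∀ m r → 0 < r → r < s → Residue s (s ℕ.* m ℕ.+ r)

residue : ∀ s .{{_ : ℕ.NonZero s}} n → Residue s n
residue s n = view {m = n / s} (m≡m%n+[m/n]*n n s) (m%n<n n s)
  where
  view : ∀ {n m r} → n ≡ r ℕ.+ m ℕ.* s → r < s → Residue s n
  view {m = m} {zero}  refl _   = subst (Residue s) (ℕₚ.*-comm s m) (multiple m)
  view {m = m} {suc r} refl r<s = subst (Residue s) (trans (ℕₚ.+-comm (s ℕ.* m) (suc r)) (cong (suc r ℕ.+_) (ℕₚ.*-comm s m)))
                                        (nonmultiple m (suc r) (s≤s z≤n) r<s)

dilate-nonmultiple : ∀ s a m {r} → 0 < r → r < s → dilate s a (s ℕ.* m ℕ.+ r) ≡ 0ℤ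
dilate-nonmultiple s a m 0<r r<s = dilate-∤ s a (∤*+ s m 0<r r<s)

dilate⊛-multiple : ∀ s .{{_ : ℕ.NonZero s}} a b n →
  (dilate s a ⊛ b) (s ℕ.* n) ≡ sumTo n (λ j → a j * b (s ℕ.* (n ∸ j)))
dilate⊛-multiple s@(suc _) a b n = begin
  (dilate s a ⊛ b) (s ℕ.* n)                           ≡⟨ cong (dilate s a ⊛ b) (sym (ℕₚ.+-identityʳ (s ℕ.* n))) ⟩
  (dilate s a ⊛ b) (s ℕ.* n ℕ.+ 0)                     ≡⟨ dilate⊛-coefficient s a b n (s≤s z≤n) ⟩
  sumTo n (λ j → a j * b (s ℕ.* (n ∸ j) ℕ.+ 0))       ≡⟨ sumTo-cong n (λ j _ → cong (λ x → a j * b x) (ℕₚ.+-identityʳ _)) ⟩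
  sumTo n (λ j → a j * b (s ℕ.* (n ∸ j)))             ∎
  where open ≡-Reasoning

dilate-⊛ : ∀ s .{{_ : ℕ.NonZero s}} a b → dilate s (a ⊛ b) ≈ dilate s a ⊛ dilate s b
dilate-⊛ s a b = coeffwise λ n → coefficient (residue s n)
  where
  coefficient : ∀ {n} → Residue s n → dilate s (a ⊛ b) n ≡ (dilate s a ⊛ dilate s b) n
  coefficient (multiple m) = begin
    dilate s (a ⊛ b) (s ℕ.* m)                          ≡⟨ dilate-* s (a ⊛ b) m ⟩
    sumTo m (λ j → a j * b (m ∸ j))                      ≡⟨ sumTo-cong m (λ j _ → cong (a j *_) (sym (dilate-* s b (m ∸ j)))) ⟩
    sumTo m (λ j → a j * dilate s b (s ℕ.* (m ∸ j)))     ≡⟨ dilate⊛-multiple s a (dilate s b) m ⟨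
    (dilate s a ⊛ dilate s b) (s ℕ.* m)                  ∎
    where open ≡-Reasoning
  coefficient (nonmultiple m r 0<r r<s) = begin
    dilate s (a ⊛ b) (s ℕ.* m ℕ.+ r)                    ≡⟨ dilate-nonmultiple s (a ⊛ b) m 0<r r<s ⟩
    0ℤ
      ≡⟨ sumTo-zero m (λ j _ → trans (cong (a j *_) (dilate-nonmultiple s b (m ∸ j) 0<r r<s)) (ℤₚ.*-zeroʳ (a j))) ⟨
    sumTo m (λ j → a j * dilate s b (s ℕ.* (m ∸ j) ℕ.+ r)) ≡⟨ dilate⊛-coefficient s a (dilate s b) m r<s ⟨
    (dilate s a ⊛ dilate s b) (s ℕ.* m ℕ.+ r)            ∎
    where open ≡-Reasoning

dilate-≈[] : ∀ s .{{_ : ℕ.NonZero s}} {a b M} → a ≈[ M ] b → dilate s a ≈[ M ] dilate s b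
dilate-≈[] s {a} {b} {M} a≈b n n<M = coefficient (residue s n) n<M
  where
  coefficient : ∀ {n} → Residue s n → n < M → dilate s a n ≡ dilate s b n
  coefficient (multiple m) sm<M =
    trans (dilate-* s a m) (trans (a≈b m (ℕₚ.≤-<-trans (ℕₚ.m≤n*m m s) sm<M)) (sym (dilate-* s b m)))
  coefficient (nonmultiple m r 0<r r<s) _ =
    trans (dilate-nonmultiple s a m 0<r r<s) (sym (dilate-nonmultiple s b m 0<r r<s))

dilate-cong : ∀ s {a b} → a ≈ b → dilate s a ≈ dilate s b
dilate-cong s a≈b = coeffwise λ n → coefficient n
  where
  coefficient : ∀ n → dilate s _ n ≡ dilate s _ n
  coefficient n with s ℕ∣.∣? n
  ... | yes _ = coeff a≈b _
  ... | no  _ = refl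

dilate-⊕ : ∀ s a b → dilate s (a ⊕ b) ≈ dilate s a ⊕ dilate s b
dilate-⊕ s a b = coeffwise λ n → coefficient n
  where
  coefficient : ∀ n → dilate s (a ⊕ b) n ≡ (dilate s a ⊕ dilate s b) n
  coefficient n with s ℕ∣.∣? n
  ... | yes _ = refl
  ... | no  _ = refl

dilate-· : ∀ s c a → dilate s (c · a) ≈ c · dilate s a
dilate-· s c a = coeffwise λ n → coefficient n
  where
  coefficient : ∀ n → dilate s (c · a) n ≡ (c · dilate s a) n
  coefficient n with s ℕ∣.∣? n
  ... | yes _ = refl
  ... | no  _ = sym (ℤₚ.*-zeroʳ c)

dilate-q^ : ∀ s .{{_ : ℕ.NonZero s}} e → dilate s (q^ e) ≈ q^ (s ℕ.* e)
dilate-q^ s e = coeffwise λ n → coefficient (residue s n)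
  where
  coefficient : ∀ {n} → Residue s n → dilate s (q^ e) n ≡ (q^ (s ℕ.* e)) n
  coefficient (multiple m) with m ℕ.≟ e
  ... | yes refl = trans (dilate-* s (q^ m) m) (trans (q^-≡ m) (sym (q^-≡ (s ℕ.* m))))
  ... | no  m≢e  = trans (dilate-* s (q^ e) m) (trans (q^-≢ e m≢e) (sym (q^-≢ (s ℕ.* e) (m≢e ∘ ℕₚ.*-cancelˡ-≡ m e s))))
  coefficient (nonmultiple m r 0<r r<s) = trans (dilate-nonmultiple s (q^ e) m 0<r r<s)
    (sym (q^-≢ (s ℕ.* e) λ sm+r≡se → ∤*+ s m 0<r r<s (subst (s ℕ∣.∣_) (sym sm+r≡se) (ℕ∣.m∣m*n e))))

dilate-⊝ : ∀ s a → dilate s (⊝ a) ≈ ⊝ dilate s a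
dilate-⊝ s a = coeffwise λ n → coefficient n
  where
  coefficient : ∀ n → dilate s (⊝ a) n ≡ - dilate s a n
  coefficient n with s ℕ∣.∣? n
  ... | yes _ = refl
  ... | no  _ = refl

dilate-oneS : ∀ s .{{_ : ℕ.NonZero s}} → dilate s oneS ≈ oneS
dilate-oneS s = ≈-trans (dilate-cong s (≈-sym q^0)) (≈-trans (dilate-q^ s 0) (≈-trans (≡⇒≈ (cong q^_ (ℕₚ.*-zeroʳ s))) q^0))

prodTo-dilate : ∀ s .{{_ : ℕ.NonZero s}} N F → prodTo N (λ i → dilate s (F i)) ≈ dilate s (prodTo N F)
prodTo-dilate s zero    F = ≈-sym (dilate-oneS s)
prodTo-dilate s (suc N) F = ≈-trans (⊛-congʳ (dilate s (F (suc N))) (prodTo-dilate s N F))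
                                    (≈-sym (dilate-⊛ s (prodTo N F) (F (suc N))))

∏-dilate : ∀ s .{{_ : ℕ.NonZero s}} {F} → Convergent F → ∏ (λ i → dilate s (F i)) ≈ dilate s (∏ F)
∏-dilate s {F} conv = coeffwise λ N →
  trans (coeff (prodTo-dilate s N F) N) (dilate-≈[] s (≈[]-sym (∏≈[]prodTo conv N)) N ℕₚ.≤-refl)

dilate-oneMinusQ^ : ∀ s .{{_ : ℕ.NonZero s}} {d} → 1 ≤ d → dilate s (oneMinusQ^ d) ≈ oneMinusQ^ (s ℕ.* d)
dilate-oneMinusQ^ s {d} 1≤d = begin
  dilate s (oneMinusQ^ d)                 ≈⟨ dilate-cong s (oneMinusQ^-≈ 1≤d) ⟩
  dilate s (oneS ⊕ ⊝ q^ d)                ≈⟨ dilate-⊕ s oneS (⊝ q^ d) ⟩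
  dilate s oneS ⊕ dilate s (⊝ q^ d)       ≈⟨ ⊕-cong (dilate-oneS s) (≈-trans (dilate-⊝ s (q^ d)) (⊝-cong (dilate-q^ s d))) ⟩
  oneS ⊕ ⊝ q^ (s ℕ.* d)                  ≈⟨ oneMinusQ^-≈ (ℕₚ.*-mono-≤ (ℕ.>-nonZero⁻¹ s) 1≤d) ⟨
  oneMinusQ^ (s ℕ.* d)                    ∎
  where open ≈-Reasoning

f-dilate : ∀ s .{{_ : ℕ.NonZero s}} k .{{_ : ℕ.NonZero k}} → f (s ℕ.* k) ≈ dilate s (f k)
f-dilate s k = ≈-trans
  (∏-cong λ i 1≤i → ≈-trans (≡⇒≈ (cong oneMinusQ^ (ℕₚ.*-assoc s k i)))
                            (≈-sym (dilate-oneMinusQ^ s (ℕₚ.*-mono-≤ (ℕ.>-nonZero⁻¹ k) 1≤i))))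
  (∏-dilate s (Convergent-f k))

dilate-zeroS : ∀ s → dilate s zeroS ≈ zeroS
dilate-zeroS s = coeffwise λ n → coefficient n
  where
  coefficient : ∀ n → dilate s zeroS n ≡ 0ℤ
  coefficient n with s ℕ∣.∣? n
  ... | yes _ = refl
  ... | no  _ = refl

*+-remainder : ∀ s .{{_ : ℕ.NonZero s}} m {r} → r < s → (s ℕ.* m ℕ.+ r) % s ≡ r
*+-remainder s m {r} r<s = begin
  (s ℕ.* m ℕ.+ r) % s    ≡⟨ cong (_% s) (trans (ℕₚ.+-comm (s ℕ.* m) r) (cong (r ℕ.+_) (ℕₚ.*-comm s m))) ⟩
  (r ℕ.+ m ℕ.* s) % s    ≡⟨ [m+kn]%n≡m%n r m s ⟩
  r % s                  ≡⟨ m<n⇒m%n≡m r<s ⟩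
  r                      ∎
  where open ≡-Reasoning

dissect-constS-⊛ : ∀ s r σ a → dissect s r (constS σ ⊛ a) ≈ constS σ ⊛ dissect s r a
dissect-constS-⊛ s r σ a = coeffwise λ n →
  trans (coeff (constS-⊛ σ a) (s ℕ.* n ℕ.+ r)) (sym (coeff (constS-⊛ σ (dissect s r a)) n))

dissect-q^ : ∀ s .{{_ : ℕ.NonZero s}} x {r} → r < s → dissect s r (q^ (s ℕ.* x ℕ.+ r)) ≈ q^ x
dissect-q^ s x {r} r<s = coeffwise λ n → coefficient n (n ℕ.≟ x)
  where
  coefficient : ∀ n → Dec (n ≡ x) → (q^ (s ℕ.* x ℕ.+ r)) (s ℕ.* n ℕ.+ r) ≡ (q^ x) n
  coefficient n (yes refl) = trans (q^-≡ _) (sym (q^-≡ n))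
  coefficient n (no n≢x)   = trans (q^-≢ _ (n≢x ∘ ℕₚ.*-cancelˡ-≡ n x s ∘ ℕₚ.+-cancelʳ-≡ r (s ℕ.* n) (s ℕ.* x))) (sym (q^-≢ x n≢x))

dissect-q^-≢ : ∀ s .{{_ : ℕ.NonZero s}} x {r r′} → r < s → r′ < s → r ≢ r′ → dissect s r (q^ (s ℕ.* x ℕ.+ r′)) ≈ zeroS
dissect-q^-≢ s x {r} {r′} r<s r′<s r≢r′ = coeffwise λ n → q^-≢ _ λ sn+r≡sx+r′ →
  r≢r′ (trans (sym (*+-remainder s n r<s)) (trans (cong (_% s) sn+r≡sx+r′) (*+-remainder s x r′<s)))

dissect-monomial : ∀ s .{{_ : ℕ.NonZero s}} σ x {r} → r < s → dissect s r (constS σ ⊛ q^ (s ℕ.* x ℕ.+ r)) ≈ constS σ ⊛ q^ x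
dissect-monomial s σ x {r} r<s = ≈-trans (dissect-constS-⊛ s r σ (q^ (s ℕ.* x ℕ.+ r))) (⊛-congˡ (constS σ) (dissect-q^ s x r<s))

dissect-monomial-≢ : ∀ s .{{_ : ℕ.NonZero s}} σ x {r r′} → r < s → r′ < s → r ≢ r′ → dissect s r (constS σ ⊛ q^ (s ℕ.* x ℕ.+ r′)) ≈ zeroS
dissect-monomial-≢ s σ x {r} {r′} r<s r′<s r≢r′ =
  ≈-trans (dissect-constS-⊛ s r σ (q^ (s ℕ.* x ℕ.+ r′))) (⊛-annihilateʳ (constS σ) (dissect-q^-≢ s x r<s r′<s r≢r′))

dilate-monomial : ∀ s .{{_ : ℕ.NonZero s}} c e → dilate s (constS c ⊛ q^ e) ≈ constS c ⊛ q^ (s ℕ.* e)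
dilate-monomial s c e = ≈-trans (dilate-cong s (constS-⊛ c (q^ e))) (≈-trans (dilate-· s c (q^ e))
  (≈-trans (coeffwise λ n → cong (c *_) (coeff (dilate-q^ s e) n)) (≈-sym (constS-⊛ c (q^ (s ℕ.* e))))))

-- Squares modulo 2

2∣i*i-i : ∀ i → + 2 ∣ℤ i * i - i
2∣i*i-i (+ n)      = 2∣n*n-n n
  where
  2∣n*n-n : ∀ n → + 2 ∣ℤ + n * + n - + n
  2∣n*n-n zero    = divides 0ℤ refl
  2∣n*n-n (suc n) = subst (+ 2 ∣ℤ_) (step (+ n)) (ℤ∣.∣m∣n⇒∣m+n (2∣n*n-n n) (divides (+ n) refl))
    where
    step : ∀ x → (x * x - x) + x * + 2 ≡ (1ℤ + x) * (1ℤ + x) - (1ℤ + x)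
    step = solve-∀
2∣i*i-i ℤ.-[1+ n ] =
  subst (+ 2 ∣ℤ_) (negate (+ suc n)) (ℤ∣.∣m∣n⇒∣m+n (2∣i*i-i (+ suc n)) (divides (+ suc n) refl))
  where
  negate : ∀ x → (x * x - x) + x * + 2 ≡ (- x) * (- x) - (- x)
  negate = solve-∀

truncate : ℕ → Series → Series
truncate N a n with n ℕ.≤? N
... | yes _ = a n
... | no  _ = 0ℤ

truncate-≤ : ∀ {N} a {n} → n ≤ N → truncate N a n ≡ a n
truncate-≤ {N} a {n} n≤N with n ℕ.≤? N
... | yes _   = refl
... | no  n≰N = ⊥-elim (n≰N n≤N)

truncate-> : ∀ {N} a {n} → N < n → truncate N a n ≡ 0ℤ
truncate-> {N} a {n} N<n with n ℕ.≤? N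
... | yes n≤N = ⊥-elim (ℕₚ.<-irrefl refl (ℕₚ.<-≤-trans N<n n≤N))
... | no  _   = refl

a≈[]truncate : ∀ N a → a ≈[ suc N ] truncate N a
a≈[]truncate N a n n<1+N = sym (truncate-≤ a (ℕₚ.≤-pred n<1+N))

truncate-zero : ∀ a → truncate 0 a ≈ zeroS ⊕ constS (a 0) ⊛ q^ 0
truncate-zero a = coeffwise λ n → trans (coefficient n) (cong (λ x → 0ℤ + x) (sym (coeff (constS-⊛ (a 0) (q^ 0)) n)))
  where
  coefficient : ∀ n → truncate 0 a n ≡ 0ℤ + a 0 * (q^ 0) n
  coefficient zero    = sym (trans (ℤₚ.+-identityˡ _) (ℤₚ.*-identityʳ (a 0)))
  coefficient (suc n) = sym (trans (ℤₚ.+-identityˡ _) (ℤₚ.*-zeroʳ (a 0)))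

truncate-suc : ∀ N a → truncate (suc N) a ≈ truncate N a ⊕ constS (a (suc N)) ⊛ q^ (suc N)
truncate-suc N a = coeffwise λ n → trans (coefficient n (ℕₚ.<-cmp n (suc N)))
  (cong (λ x → truncate N a n + x) (sym (coeff (constS-⊛ (a (suc N)) (q^ suc N)) n)))
  where
  coefficient : ∀ n → Tri (n < suc N) (n ≡ suc N) (suc N < n) → truncate (suc N) a n ≡ truncate N a n + a (suc N) * (q^ suc N) n
  coefficient n (tri< n<1+N _ _) = begin
    truncate (suc N) a n                        ≡⟨ truncate-≤ a (ℕₚ.<⇒≤ n<1+N) ⟩
    a n                                         ≡⟨ ℤₚ.+-identityʳ (a n) ⟨
    a n + 0ℤ                                    ≡⟨ cong₂ _+_ (truncate-≤ a (ℕₚ.≤-pred n<1+N)) (ℤₚ.*-zeroʳ (a (suc N))) ⟨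
    truncate N a n + a (suc N) * 0ℤ             ≡⟨ cong (λ x → truncate N a n + a (suc N) * x) (q^-< (suc N) n<1+N) ⟨
    truncate N a n + a (suc N) * (q^ suc N) n   ∎
    where open ≡-Reasoning
  coefficient n (tri≈ _ refl _) = begin
    truncate (suc N) a (suc N)                      ≡⟨ truncate-≤ a ℕₚ.≤-refl ⟩
    a (suc N)                                       ≡⟨ trans (ℤₚ.+-identityˡ _) (ℤₚ.*-identityʳ (a (suc N))) ⟨
    0ℤ + a (suc N) * 1ℤ                             ≡⟨ cong₂ (λ x y → x + a (suc N) * y) (truncate-> {N} a ℕₚ.≤-refl) (q^-≡ (suc N)) ⟨
    truncate N a (suc N) + a (suc N) * (q^ suc N) (suc N) ∎
    where open ≡-Reasoning
  coefficient n (tri> _ _ 1+N<n) = begin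
    truncate (suc N) a n                        ≡⟨ truncate-> a 1+N<n ⟩
    0ℤ                                          ≡⟨ trans (ℤₚ.+-identityˡ _) (ℤₚ.*-zeroʳ (a (suc N))) ⟨
    0ℤ + a (suc N) * 0ℤ                         ≡⟨ cong₂ (λ x y → x + a (suc N) * y)
                                                     (truncate-> {N} a (ℕₚ.<-trans (ℕₚ.n<1+n N) 1+N<n))
                                                     (q^-≢ (suc N) (λ { refl → ℕₚ.<-irrefl refl 1+N<n })) ⟨
    truncate N a n + a (suc N) * (q^ suc N) n   ∎
    where open ≡-Reasoning

SquareIsDilate : Series → Set
SquareIsDilate a = a ⊛ a ≡[mod + 2 ] dilate 2 a

SquareIsDilate-resp : ∀ {a b} → a ≈ b → SquareIsDilate b → SquareIsDilate a
SquareIsDilate-resp a≈b b²≡b[q²] =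
  ≡[mod]-trans (≈⇒≡[mod] (+ 2) (⊛-cong a≈b a≈b)) (≡[mod]-trans b²≡b[q²] (≈⇒≡[mod] (+ 2) (dilate-cong 2 (≈-sym a≈b))))

-- (p + c q^e)² = p² + 2 c p q^e + c² q^(2e), and c² ≡ c (mod 2)
SquareIsDilate-+monomial : ∀ p c e → SquareIsDilate p → SquareIsDilate (p ⊕ constS c ⊛ q^ e)
SquareIsDilate-+monomial p c e p²≡p[q²] = begin
  (p ⊕ C ⊛ Q) ⊛ (p ⊕ C ⊛ Q)
    ≈⟨ ≈⇒≡[mod] (+ 2) (solve 3 (λ p C Q → (p :+ C :* Q) :* (p :+ C :* Q) := p :* p :+ con (+ 2) :* (p :* (C :* Q)) :+ (C :* C) :* (Q :* Q)) ≈-refl p C Q) ⟩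
  p ⊛ p ⊕ constS (+ 2) ⊛ (p ⊛ (C ⊛ Q)) ⊕ (C ⊛ C) ⊛ (Q ⊛ Q)
    ≈⟨ ⊕-cong-mod (⊕-cong-mod p²≡p[q²] (multiple≡[mod]0 (+ 2) (p ⊛ (C ⊛ Q)))) (≈⇒≡[mod] (+ 2) (⊛-cong (≈-sym (constS-* c c)) Q²)) ⟩
  dilate 2 p ⊕ zeroS ⊕ constS (c * c) ⊛ q^ (2 ℕ.* e)
    ≈⟨ ⊕-cong-mod (≈⇒≡[mod] (+ 2) (⊕-identityʳ (dilate 2 p))) (constS-⊛-cong-mod (c * c) c (q^ (2 ℕ.* e)) (2∣i*i-i c)) ⟩
  dilate 2 p ⊕ C ⊛ q^ (2 ℕ.* e)
    ≈⟨ ≈⇒≡[mod] (+ 2) (≈-sym (≈-trans (dilate-⊕ 2 p (C ⊛ Q)) (⊕-congˡ (dilate 2 p) (dilate-monomial 2 c e)))) ⟩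
  dilate 2 (p ⊕ C ⊛ Q) ∎
  where
  open ≡[mod]-Reasoning (+ 2)
  C = constS c
  Q = q^ e
  Q² : Q ⊛ Q ≈ q^ (2 ℕ.* e)
  Q² = ≈-trans (q^-+ e e) (≡⇒≈ (cong q^_ (cong (e ℕ.+_) (sym (ℕₚ.+-identityʳ e)))))

SquareIsDilate-truncate : ∀ a N → SquareIsDilate (truncate N a)
SquareIsDilate-truncate a zero    = SquareIsDilate-resp (truncate-zero a) (SquareIsDilate-+monomial zeroS (a 0) 0
  (≡[mod]-trans (≈⇒≡[mod] (+ 2) (⊛-zeroʳ zeroS)) (≈⇒≡[mod] (+ 2) (≈-sym (dilate-zeroS 2)))))
SquareIsDilate-truncate a (suc N) = SquareIsDilate-resp (truncate-suc N a)
  (SquareIsDilate-+monomial (truncate N a) (a (suc N)) (suc N) (SquareIsDilate-truncate a N))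

frobenius : ∀ a → SquareIsDilate a
frobenius a = ∣⇒≡[mod] λ n → subst (+ 2 ∣ℤ_)
  (cong₂ _-_ (sym (⊛-cong[] (a≈[]truncate n a) (a≈[]truncate n a) n ℕₚ.≤-refl))
             (sym (dilate-≈[] 2 (a≈[]truncate n a) n ℕₚ.≤-refl)))
  (≡[mod]⇒∣ (SquareIsDilate-truncate a n) n)

-- Gaussian polynomials

module GaussianPolynomials (s : ℕ) .{{_ : ℕ.NonZero s}} where

  open ≈-Reasoning

  Q^_ : ℕ → Series
  Q^ x = q^ (s ℕ.* x)

  Q^-+ : ∀ x y → Q^ x ⊛ Q^ y ≈ Q^ (x ℕ.+ y)
  Q^-+ x y = ≈-trans (q^-+ (s ℕ.* x) (s ℕ.* y)) (≡⇒≈ (cong q^_ (sym (ℕₚ.*-distribˡ-+ s x y))))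

  Q^0 : Q^ 0 ≈ oneS
  Q^0 = ≈-trans (≡⇒≈ (cong q^_ (ℕₚ.*-zeroʳ s))) q^0

  [_choose_] : ℕ → ℕ → Series
  [ zero  choose zero  ] = oneS
  [ zero  choose suc j ] = zeroS
  [ suc n choose zero  ] = oneS
  [ suc n choose suc j ] = [ n choose j ] ⊕ Q^ (suc j) ⊛ [ n choose suc j ]

  choose-zero : ∀ n → [ n choose 0 ] ≈ oneS
  choose-zero zero    = ≈-refl
  choose-zero (suc n) = ≈-refl

  choose-> : ∀ {n j} → n < j → [ n choose j ] ≈ zeroS
  choose-> {zero}  {suc j} _         = ≈-refl
  choose-> {suc n} {suc j} (s≤s n<j) =
    ≈-trans (⊕-cong (choose-> n<j) (⊛-annihilateʳ (Q^ suc j) (choose-> (ℕₚ.m≤n⇒m≤1+n n<j)))) (⊕-identityʳ zeroS)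

  Q^-absorb : ∀ n j → Q^ (suc (suc j)) ⊛ (Q^ (n ∸ suc j) ⊛ [ n choose suc j ]) ≈ Q^ (suc n) ⊛ [ n choose suc j ]
  Q^-absorb n j with suc j ℕ.≤? n
  ... | yes j<n = ≈-trans (≈-sym (⊛-assoc (Q^ suc (suc j)) (Q^ (n ∸ suc j)) [ n choose suc j ]))
    (⊛-congʳ [ n choose suc j ] (≈-trans (Q^-+ (suc (suc j)) (n ∸ suc j)) (≡⇒≈ (cong (λ x → Q^ suc x) (ℕₚ.m+[n∸m]≡n j<n)))))
  ... | no  j≮n = ≈-trans (⊛-annihilateʳ (Q^ suc (suc j)) (⊛-annihilateʳ (Q^ (n ∸ suc j)) vanishes))
                          (≈-sym (⊛-annihilateʳ (Q^ suc n) vanishes))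
    where vanishes = choose-> (ℕₚ.≰⇒> j≮n)

  -- the Pascal rule with the power of Q on the other term
  Pascal₂ : ℕ → ℕ → Set
  Pascal₂ n j = [ suc n choose suc j ] ≈ Q^ (n ∸ j) ⊛ [ n choose j ] ⊕ [ n choose suc j ]

  private
    expand : ∀ m j → Pascal₂ m j → Pascal₂ m (suc j) →
      [ suc (suc m) choose suc (suc j) ] ≈
        (Q^ (m ∸ j) ⊛ [ m choose j ] ⊕ [ m choose suc j ]) ⊕ (Q^ suc m ⊛ [ m choose suc j ] ⊕ Q^ suc (suc j) ⊛ [ m choose suc (suc j) ])
    expand m j pascal pascal′ = begin
      [ suc m choose suc j ] ⊕ Q^ suc (suc j) ⊛ [ suc m choose suc (suc j) ]
        ≈⟨ ⊕-cong pascal (⊛-congˡ (Q^ suc (suc j)) pascal′) ⟩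
      (Q^ (m ∸ j) ⊛ A ⊕ B) ⊕ Q^ suc (suc j) ⊛ (Q^ (m ∸ suc j) ⊛ B ⊕ C)
        ≈⟨ ⊕-congˡ (Q^ (m ∸ j) ⊛ A ⊕ B) (⊛-distribˡ (Q^ suc (suc j)) (Q^ (m ∸ suc j) ⊛ B) C) ⟩
      (Q^ (m ∸ j) ⊛ A ⊕ B) ⊕ (Q^ suc (suc j) ⊛ (Q^ (m ∸ suc j) ⊛ B) ⊕ Q^ suc (suc j) ⊛ C)
        ≈⟨ ⊕-congˡ (Q^ (m ∸ j) ⊛ A ⊕ B) (⊕-congʳ (Q^ suc (suc j) ⊛ C) (Q^-absorb m j)) ⟩
      (Q^ (m ∸ j) ⊛ A ⊕ B) ⊕ (Q^ suc m ⊛ B ⊕ Q^ suc (suc j) ⊛ C) ∎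
      where
      A = [ m choose j ]
      B = [ m choose suc j ]
      C = [ m choose suc (suc j) ]

  pascal₂ : ∀ n j → Pascal₂ n j
  pascal₂ n j with j ℕ.≤? n
  ... | no j≰n = ≈-trans (choose-> (s≤s n<j)) (≈-sym (≈-trans
          (⊕-cong (⊛-annihilateʳ (Q^ (n ∸ j)) (choose-> n<j)) (choose-> (ℕₚ.m≤n⇒m≤1+n n<j))) (⊕-identityʳ zeroS)))
    where n<j = ℕₚ.≰⇒> j≰n
  pascal₂ zero zero | yes _ = ≈-trans (⊕-congˡ oneS (⊛-zeroʳ (Q^ 1)))
                                      (≈-sym (⊕-congʳ zeroS (≈-trans (⊛-congʳ oneS Q^0) (⊛-identityˡ oneS))))
  pascal₂ (suc n) zero | yes _ = begin
    oneS ⊕ Q^ 1 ⊛ [ suc n choose 1 ]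
      ≈⟨ ⊕-congˡ oneS (⊛-congˡ (Q^ 1) (≈-trans (pascal₂ n 0) (⊕-congʳ [ n choose 1 ] (⊛-congˡ (Q^ n) (choose-zero n))))) ⟩
    oneS ⊕ Q^ 1 ⊛ (Q^ n ⊛ oneS ⊕ [ n choose 1 ])
      ≈⟨ solve 4 (λ one q₁ qₙ b → one :+ q₁ :* (qₙ :* one :+ b) := (q₁ :* qₙ) :* one :+ (one :+ q₁ :* b)) ≈-refl oneS (Q^ 1) (Q^ n) [ n choose 1 ] ⟩
    (Q^ 1 ⊛ Q^ n) ⊛ oneS ⊕ (oneS ⊕ Q^ 1 ⊛ [ n choose 1 ])
      ≈⟨ ⊕-cong (⊛-congʳ oneS (Q^-+ 1 n)) (⊕-congʳ (Q^ 1 ⊛ [ n choose 1 ]) (≈-sym (choose-zero n))) ⟩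
    Q^ suc n ⊛ oneS ⊕ [ suc n choose 1 ] ∎
  pascal₂ (suc n) (suc j) | yes (s≤s j≤n) = begin
    [ suc (suc n) choose suc (suc j) ]
      ≈⟨ expand n j (pascal₂ n j) (pascal₂ n (suc j)) ⟩
    (Q^ (n ∸ j) ⊛ A ⊕ B) ⊕ (Q^ suc n ⊛ B ⊕ Q^ suc (suc j) ⊛ C)
      ≈⟨ ⊕-congˡ (Q^ (n ∸ j) ⊛ A ⊕ B) (⊕-congʳ (Q^ suc (suc j) ⊛ C) (⊛-congʳ B Q^n-j+1+j)) ⟨
    (Q^ (n ∸ j) ⊛ A ⊕ B) ⊕ ((Q^ (n ∸ j) ⊛ Q^ suc j) ⊛ B ⊕ Q^ suc (suc j) ⊛ C)
      ≈⟨ solve 6 (λ qa a qb b qc c → (qa :* a :+ b) :+ ((qa :* qb) :* b :+ qc :* c) := qa :* (a :+ qb :* b) :+ (b :+ qc :* c)) ≈-refl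
                 (Q^ (n ∸ j)) A (Q^ suc j) B (Q^ suc (suc j)) C ⟩
    Q^ (n ∸ j) ⊛ [ suc n choose suc j ] ⊕ [ suc n choose suc (suc j) ] ∎
    where
    A = [ n choose j ]
    B = [ n choose suc j ]
    C = [ n choose suc (suc j) ]
    Q^n-j+1+j : Q^ (n ∸ j) ⊛ Q^ suc j ≈ Q^ suc n
    Q^n-j+1+j = ≈-trans (Q^-+ (n ∸ j) (suc j)) (≡⇒≈ (cong Q^_ (trans (ℕₚ.+-suc (n ∸ j) j) (cong suc (ℕₚ.m∸n+n≡m j≤n)))))

  choose-+2 : ∀ m j → [ suc (suc m) choose suc (suc j) ] ≈
    [ m choose suc j ] ⊕ Q^ suc m ⊛ [ m choose suc j ] ⊕ Q^ (m ∸ j) ⊛ [ m choose j ] ⊕ Q^ suc (suc j) ⊛ [ m choose suc (suc j) ]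
  choose-+2 m j = ≈-trans (expand m j (pascal₂ m j) (pascal₂ m (suc j)))
    (solve 6 (λ qₘ qₐ a b q꜀ c → (qₐ :* a :+ b) :+ (qₘ :* b :+ q꜀ :* c) := b :+ qₘ :* b :+ qₐ :* a :+ q꜀ :* c) ≈-refl
             (Q^ suc m) (Q^ (m ∸ j)) [ m choose j ] [ m choose suc j ] (Q^ suc (suc j)) [ m choose suc (suc j) ])

  choose-+2-1 : ∀ m → [ suc (suc m) choose 1 ] ≈ [ m choose 0 ] ⊕ Q^ suc m ⊛ [ m choose 0 ] ⊕ Q^ 1 ⊛ [ m choose 1 ]
  choose-+2-1 m = begin
    oneS ⊕ Q^ 1 ⊛ [ suc m choose 1 ]
      ≈⟨ ⊕-cong (≈-sym (choose-zero m)) (⊛-congˡ (Q^ 1) (pascal₂ m 0)) ⟩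
    [ m choose 0 ] ⊕ Q^ 1 ⊛ (Q^ m ⊛ [ m choose 0 ] ⊕ [ m choose 1 ])
      ≈⟨ solve 4 (λ a q₁ qₘ b → a :+ q₁ :* (qₘ :* a :+ b) := a :+ (q₁ :* qₘ) :* a :+ q₁ :* b) ≈-refl [ m choose 0 ] (Q^ 1) (Q^ m) [ m choose 1 ] ⟩
    [ m choose 0 ] ⊕ (Q^ 1 ⊛ Q^ m) ⊛ [ m choose 0 ] ⊕ Q^ 1 ⊛ [ m choose 1 ]
      ≈⟨ ⊕-congʳ (Q^ 1 ⊛ [ m choose 1 ]) (⊕-congˡ [ m choose 0 ] (⊛-congʳ [ m choose 0 ] (Q^-+ 1 m))) ⟩
    [ m choose 0 ] ⊕ Q^ suc m ⊛ [ m choose 0 ] ⊕ Q^ 1 ⊛ [ m choose 1 ] ∎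

  pochhammer : ℕ → Series
  pochhammer j = prodTo j (λ i → oneMinusQ^ (s ℕ.* i))

  1≤s* : ∀ {i} → 1 ≤ i → 1 ≤ s ℕ.* i
  1≤s* = ℕₚ.*-mono-≤ (ℕ.>-nonZero⁻¹ s)

  -- (Q; Q)_j [n choose j] = (Q; Q)_n / (Q; Q)_(n - j) ≡ 1 (mod Q^(n - j + 1))
  pochhammer⊛choose : ∀ n j → j ≤ n → pochhammer j ⊛ [ n choose j ] ≈[ s ℕ.* suc (n ∸ j) ] oneS
  pochhammer⊛choose n zero _ = ≈⇒≈[] _ (≈-trans (⊛-congˡ oneS (choose-zero n)) (⊛-identityˡ oneS))
  pochhammer⊛choose (suc n) (suc j) (s≤s j≤n) = ≈[]-trans (≈⇒≈[] M recursion) (step (suc j ℕ.≤? n))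
    where
    M = s ℕ.* suc (n ∸ j)
    G = oneMinusQ^ (s ℕ.* suc j)
    recursion : pochhammer (suc j) ⊛ [ suc n choose suc j ] ≈
                G ⊛ (pochhammer j ⊛ [ n choose j ]) ⊕ Q^ suc j ⊛ (pochhammer (suc j) ⊛ [ n choose suc j ])
    recursion = solve 5 (λ p g a q b → (p :* g) :* (a :+ q :* b) := g :* (p :* a) :+ q :* ((p :* g) :* b)) ≈-refl
                        (pochhammer j) G [ n choose j ] (Q^ suc j) [ n choose suc j ]
    first : G ⊛ (pochhammer j ⊛ [ n choose j ]) ≈[ M ] G
    first = ≈[]-trans (⊛-cong[] (≈[]-refl {G} M) (pochhammer⊛choose n j j≤n)) (≈⇒≈[] M (⊛-identityʳ G))
    G⊕Q^ : G ⊕ Q^ suc j ≈ oneS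
    G⊕Q^ = ≈-trans (⊕-congʳ (Q^ suc j) (oneMinusQ^-≈ (1≤s* (s≤s z≤n))))
                   (solve 2 (λ o q → (o :- q) :+ q := o) ≈-refl oneS (Q^ suc j))
    step : Dec (suc j ≤ n) → G ⊛ (pochhammer j ⊛ [ n choose j ]) ⊕ Q^ suc j ⊛ (pochhammer (suc j) ⊛ [ n choose suc j ]) ≈[ M ] oneS
    step (yes j<n) = ≈[]-trans (⊕-cong[] first second) (≈⇒≈[] M G⊕Q^)
      where
      M≤ : M ≤ s ℕ.* suc j ℕ.+ s ℕ.* suc (n ∸ suc j)
      M≤ = ℕₚ.≤-trans (ℕₚ.*-monoʳ-≤ s (s≤s (ℕₚ.m∸n≤m n j))) (ℕₚ.≤-reflexive (trans (cong (s ℕ.*_) (sym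
             (trans (cong suc (ℕₚ.+-suc j (n ∸ suc j))) (cong suc (ℕₚ.m+[n∸m]≡n j<n))))) (ℕₚ.*-distribˡ-+ s (suc j) (suc (n ∸ suc j)))))
      second : Q^ suc j ⊛ (pochhammer (suc j) ⊛ [ n choose suc j ]) ≈[ M ] Q^ suc j
      second = ≈[]-weaken M≤ (≈[]-trans (q^⊛-cong[] (s ℕ.* suc j) (pochhammer⊛choose n (suc j) j<n))
                                        (≈⇒≈[] _ (⊛-identityʳ (Q^ suc j))))
    step (no j≮n) = ≈[]-trans (⊕-cong[] first (≈⇒≈[] M second)) (≈[]-trans (≈⇒≈[] M (⊕-identityʳ G)) G≈1)
      where
      second : Q^ suc j ⊛ (pochhammer (suc j) ⊛ [ n choose suc j ]) ≈ zeroS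
      second = ⊛-annihilateʳ (Q^ suc j) (⊛-annihilateʳ (pochhammer (suc j)) (choose-> (ℕₚ.≰⇒> j≮n)))
      n∸j≡0 : n ∸ j ≡ 0
      n∸j≡0 = ℕₚ.m≤n⇒m∸n≡0 (ℕₚ.≤-pred (ℕₚ.≰⇒> j≮n))
      G≈1 : G ≈[ M ] oneS
      G≈1 = ≈[]-weaken (ℕₚ.*-monoʳ-≤ s (s≤s (ℕₚ.≤-trans (ℕₚ.≤-reflexive n∸j≡0) z≤n))) (oneMinusQ^≈[] (1≤s* (s≤s z≤n)))

  f≈[]pochhammer : ∀ j → f s ≈[ s ℕ.* suc j ] pochhammer j
  f≈[]pochhammer j = ≈[]-trans
    (≈[]-weaken (ℕₚ.n≤1+n _) (∏≈[]prodTo (Convergent-f s) (s ℕ.* suc j)))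
    (prodTo-stable j (s ℕ.* suc j) _ (s ℕ.* suc j) (ℕₚ.≤-trans (ℕₚ.n≤1+n j) (ℕₚ.m≤n*m (suc j) s))
      (λ i j<i _ → ≈[]-weaken (ℕₚ.*-monoʳ-≤ s j<i) (oneMinusQ^≈[] (1≤s* (ℕₚ.<-≤-trans (s≤s z≤n) j<i)))))

  f⊛choose : ∀ {n j M} → j ≤ n → M ≤ s ℕ.* suc j → M ≤ s ℕ.* suc (n ∸ j) → f s ⊛ [ n choose j ] ≈[ M ] oneS
  f⊛choose {n} {j} {M} j≤n M≤ M≤′ = ≈[]-trans (⊛-cong[] (≈[]-weaken M≤ (f≈[]pochhammer j)) (≈[]-refl {[ n choose j ]} M))
                                              (≈[]-weaken M≤′ (pochhammer⊛choose n j j≤n))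

-- Jacobi's triple product identity

symmetricSum : ℕ → (ℤ → Series) → Series
symmetricSum zero    g = g (+ 0)
symmetricSum (suc N) g = symmetricSum N g ⊕ (g (+ suc N) ⊕ g ℤ.-[1+ N ])

sumS-⊖ : ∀ N g → sumS (N ℕ.+ N) (λ j → g (j ⊖ N)) ≈ symmetricSum N g
sumS-⊖ zero    g = ≈-refl
sumS-⊖ (suc N) g = begin
  sumS (suc N ℕ.+ suc N) (λ j → g (j ⊖ suc N))
    ≈⟨ ≡⇒≈ (cong (λ M → sumS (suc M) (λ j → g (j ⊖ suc N))) (ℕₚ.+-suc N N)) ⟩
  sumS (suc (suc (N ℕ.+ N))) (λ j → g (j ⊖ suc N))
    ≈⟨ sumS-shift (suc (N ℕ.+ N)) (λ j → g (j ⊖ suc N)) ⟩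
  g ℤ.-[1+ N ] ⊕ (sumS (N ℕ.+ N) (λ j → g (suc j ⊖ suc N)) ⊕ g (suc (suc (N ℕ.+ N)) ⊖ suc N))
    ≈⟨ ⊕-congˡ (g ℤ.-[1+ N ]) (⊕-cong (≈-trans (sumS-cong (N ℕ.+ N) (λ j _ → ≡⇒≈ (cong g (ℤₚ.[1+m]⊖[1+n]≡m⊖n j N)))) (sumS-⊖ N g))
                                      (≡⇒≈ (cong g top))) ⟩
  g ℤ.-[1+ N ] ⊕ (symmetricSum N g ⊕ g (+ suc N))
    ≈⟨ solve 3 (λ x y z → x :+ (y :+ z) := y :+ (z :+ x)) ≈-refl (g ℤ.-[1+ N ]) (symmetricSum N g) (g (+ suc N)) ⟩
  symmetricSum (suc N) g ∎
  where
  open ≈-Reasoning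
  top : suc (suc (N ℕ.+ N)) ⊖ suc N ≡ + suc N
  top = trans (ℤₚ.[1+m]⊖[1+n]≡m⊖n (suc (N ℕ.+ N)) N)
              (trans (ℤₚ.⊖-≥ (ℕₚ.≤-trans (ℕₚ.m≤m+n N N) (ℕₚ.n≤1+n _)))
                     (cong +_ (trans (ℕₚ.+-∸-assoc 1 (ℕₚ.m≤m+n N N)) (cong suc (ℕₚ.m+n∸m≡n N N)))))

module JacobiTripleProduct (a : ℕ) where

  c s : ℕ
  c = suc a
  s = c ℕ.+ c

  open GaussianPolynomials s public

  exponent : ℤ → ℕ
  exponent (+ K)      = K ℕ.* (c ℕ.* K ℕ.+ a)
  exponent ℤ.-[1+ L ] = suc L ℕ.* (c ℕ.* L ℕ.+ 1)

  exponent-ℤ : ∀ k → + exponent k ≡ (1ℤ + + a) * k * k + + a * k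
  exponent-ℤ (+ K) = begin
    + (K ℕ.* (c ℕ.* K ℕ.+ a))          ≡⟨ ℤₚ.pos-* K _ ⟩
    + K * (+ (c ℕ.* K) + + a)          ≡⟨ cong (λ x → + K * (x + + a)) (ℤₚ.pos-* c K) ⟩
    + K * ((1ℤ + + a) * + K + + a)     ≡⟨ polynomial (+ a) (+ K) ⟩
    (1ℤ + + a) * + K * + K + + a * + K ∎
    where
    open ≡-Reasoning
    polynomial : ∀ a k → k * ((1ℤ + a) * k + a) ≡ (1ℤ + a) * k * k + a * k
    polynomial = solve-∀
  exponent-ℤ ℤ.-[1+ L ] = begin
    + (suc L ℕ.* (c ℕ.* L ℕ.+ 1))             ≡⟨ ℤₚ.pos-* (suc L) _ ⟩
    + suc L * (+ (c ℕ.* L) + 1ℤ)              ≡⟨ cong (λ x → + suc L * (x + 1ℤ)) (ℤₚ.pos-* c L) ⟩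
    (1ℤ + + L) * ((1ℤ + + a) * + L + 1ℤ)      ≡⟨ polynomial (+ a) (+ L) ⟩
    (1ℤ + + a) * - (1ℤ + + L) * - (1ℤ + + L) + + a * - (1ℤ + + L) ∎
    where
    open ≡-Reasoning
    polynomial : ∀ a l → (1ℤ + l) * ((1ℤ + a) * l + 1ℤ) ≡ (1ℤ + a) * - (1ℤ + l) * - (1ℤ + l) + a * - (1ℤ + l)
    polynomial = solve-∀

  α β : ℕ → ℕ
  α N = s ℕ.* N ℕ.+ c ℕ.+ a
  β N = s ℕ.* N ℕ.+ 1

  N<β : ∀ N → N < β N
  N<β N = ℕₚ.≤-trans (s≤s (ℕₚ.m≤n*m N s)) (ℕₚ.≤-reflexive (ℕₚ.+-comm 1 (s ℕ.* N)))

  β≤α : ∀ N → β N ≤ α N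
  β≤α N = ℕₚ.≤-trans (ℕₚ.+-monoʳ-≤ (s ℕ.* N) (s≤s (z≤n {a}))) (ℕₚ.m≤m+n (s ℕ.* N ℕ.+ c) a)

  1≤β : ∀ N → 1 ≤ β N
  1≤β N = ℕₚ.≤-trans (s≤s z≤n) (N<β N)

  1≤α : ∀ N → 1 ≤ α N
  1≤α N = ℕₚ.≤-trans (1≤β N) (β≤α N)

  exponent-⊖ : ∀ m n → + exponent (m ⊖ n) ≡ (1ℤ + + a) * (+ m - + n) * (+ m - + n) + + a * (+ m - + n)
  exponent-⊖ m n = trans (exponent-ℤ (m ⊖ n)) (cong (λ k → (1ℤ + + a) * k * k + + a * k) (sym (ℤₚ.m-n≡m⊖n m n)))

  -- consecutive exponents differ by e(k + 1) - e(k) = s k + c + a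
  exponent-β : ∀ i N → exponent (i ⊖ suc N) ℕ.+ s ℕ.* i ≡ β N ℕ.+ exponent (suc i ⊖ suc N)
  exponent-β i N = ℤₚ.+-injective (begin
    + exponent (i ⊖ suc N) + + (s ℕ.* i)             ≡⟨ cong₂ _+_ (exponent-⊖ i (suc N)) (ℤₚ.pos-* s i) ⟩
    P (+ i - (1ℤ + + N)) + (2+2a * + i)               ≡⟨ polynomial (+ a) (+ i) (+ N) ⟩
    2+2a * + N + 1ℤ + P ((1ℤ + + i) - (1ℤ + + N))     ≡⟨ cong₂ (λ x y → x + 1ℤ + y) (ℤₚ.pos-* s N) (exponent-⊖ (suc i) (suc N)) ⟨
    + (β N) + + exponent (suc i ⊖ suc N)             ∎)
    where
    open ≡-Reasoning
    2+2a = (1ℤ + + a) + (1ℤ + + a)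
    P : ℤ → ℤ
    P k = (1ℤ + + a) * k * k + + a * k
    polynomial : ∀ a i N → let P = λ k → (1ℤ + a) * k * k + a * k in
      P (i - (1ℤ + N)) + ((1ℤ + a) + (1ℤ + a)) * i ≡ ((1ℤ + a) + (1ℤ + a)) * N + 1ℤ + P ((1ℤ + i) - (1ℤ + N))
    polynomial = solve-∀

  exponent-α : ∀ j X N → j ℕ.+ X ≡ N ℕ.+ N → exponent (suc j ⊖ N) ℕ.+ s ℕ.* X ≡ α N ℕ.+ exponent (j ⊖ N)
  exponent-α j X N j+X≡2N = ℤₚ.+-injective (begin
    + exponent (suc j ⊖ N) + + (s ℕ.* X)                ≡⟨ cong₂ _+_ (exponent-⊖ (suc j) N) (trans (ℤₚ.pos-* s X) (cong (2+2a *_) X≡)) ⟩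
    P ((1ℤ + + j) - + N) + 2+2a * ((+ N + + N) - + j)     ≡⟨ polynomial (+ a) (+ j) (+ N) ⟩
    2+2a * + N + (1ℤ + + a) + + a + P (+ j - + N)         ≡⟨ cong₂ (λ x y → x + + c + + a + y) (ℤₚ.pos-* s N) (exponent-⊖ j N) ⟨
    + (α N) + + exponent (j ⊖ N)                        ∎)
    where
    open ≡-Reasoning
    2+2a = (1ℤ + + a) + (1ℤ + + a)
    P : ℤ → ℤ
    P k = (1ℤ + + a) * k * k + + a * k
    X≡ : + X ≡ (+ N + + N) - + j
    X≡ = trans (cancel (+ X) (+ j)) (cong (_- + j) (cong +_ j+X≡2N))
      where cancel : ∀ x j → x ≡ (j + x) - j
            cancel = solve-∀
    polynomial : ∀ a j N → let P = λ k → (1ℤ + a) * k * k + a * k in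
      P ((1ℤ + j) - N) + ((1ℤ + a) + (1ℤ + a)) * ((N + N) - j) ≡ ((1ℤ + a) + (1ℤ + a)) * N + (1ℤ + a) + a + P (j - N)
    polynomial = solve-∀

  sgn : ℤ → ℤ
  sgn k = -1ℤ ℤ.^ ℤ.∣ k ∣

  sgn-suc : ∀ m n → sgn (suc m ⊖ n) ≡ - sgn (m ⊖ n)
  sgn-suc m n with n ℕ.≤? m
  ... | yes n≤m = begin
    -1ℤ ℤ.^ ℤ.∣ suc m ⊖ n ∣       ≡⟨ cong (λ k → -1ℤ ℤ.^ ℤ.∣ k ∣) (ℤₚ.⊖-≥ (ℕₚ.m≤n⇒m≤1+n n≤m)) ⟩
    -1ℤ ℤ.^ (suc m ∸ n)           ≡⟨ cong (-1ℤ ℤ.^_) (ℕₚ.+-∸-assoc 1 n≤m) ⟩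
    -1ℤ * -1ℤ ℤ.^ (m ∸ n)         ≡⟨ ℤₚ.-1*i≡-i _ ⟩
    - (-1ℤ ℤ.^ (m ∸ n))           ≡⟨ cong (λ k → - (-1ℤ ℤ.^ ℤ.∣ k ∣)) (ℤₚ.⊖-≥ n≤m) ⟨
    - (-1ℤ ℤ.^ ℤ.∣ m ⊖ n ∣)       ∎
    where open ≡-Reasoning
  ... | no n≰m = begin
    -1ℤ ℤ.^ ℤ.∣ suc m ⊖ n ∣       ≡⟨ cong (-1ℤ ℤ.^_) (ℤₚ.∣⊖∣-≤ m<n) ⟩
    -1ℤ ℤ.^ (n ∸ suc m)           ≡⟨ ℤₚ.neg-involutive _ ⟨
    - - (-1ℤ ℤ.^ (n ∸ suc m))     ≡⟨ cong -_ (ℤₚ.-1*i≡-i _) ⟨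
    - (-1ℤ * -1ℤ ℤ.^ (n ∸ suc m)) ≡⟨ cong (λ k → - (-1ℤ ℤ.^ k)) (sym (ℕₚ.+-∸-assoc 1 m<n)) ⟩
    - (-1ℤ ℤ.^ (n ∸ m))           ≡⟨ cong (λ k → - (-1ℤ ℤ.^ k)) (ℤₚ.∣⊖∣-≤ (ℕₚ.<⇒≤ m<n)) ⟨
    - (-1ℤ ℤ.^ ℤ.∣ m ⊖ n ∣)       ∎
    where
    open ≡-Reasoning
    m<n = ℕₚ.≰⇒> n≰m

  exponent-β′ : ∀ i N → exponent (i ⊖ N) ℕ.+ s ℕ.* suc i ≡ β N ℕ.+ exponent (suc i ⊖ N)
  exponent-β′ i N = subst₂ (λ k k′ → exponent k ℕ.+ s ℕ.* suc i ≡ β N ℕ.+ exponent k′)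
    (ℤₚ.[1+m]⊖[1+n]≡m⊖n i N) (ℤₚ.[1+m]⊖[1+n]≡m⊖n (suc i) N) (exponent-β (suc i) N)

  sgn-flip : ∀ m n → sgn (m ⊖ n) ≡ - sgn (suc m ⊖ n)
  sgn-flip m n = trans (sym (ℤₚ.neg-involutive _)) (cong -_ (sym (sgn-suc m n)))

  -- the j-th term of  Σ_{|k| ≤ N} (-1)^k q^(c k² + a k) [2N choose N + k]  (in the base Q = q^s), k = j - N
  term : ℕ → ℕ → Series
  term N j = constS (sgn (j ⊖ N)) ⊛ (q^ exponent (j ⊖ N) ⊛ [ N ℕ.+ N choose j ])

  finiteTheta : ℕ → Series
  finiteTheta N = sumS (N ℕ.+ N) (term N)

  factor : Family
  factor zero    = oneS
  factor (suc N) = oneMinusQ^ (α N) ⊛ oneMinusQ^ (β N)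

  term-> : ∀ N j → N ℕ.+ N < j → term N j ≈ zeroS
  term-> N j 2N<j = ⊛-annihilateʳ (constS (sgn (j ⊖ N))) (⊛-annihilateʳ (q^ exponent (j ⊖ N)) (choose-> 2N<j))

  term-suc : ∀ N j → term (suc N) (suc j) ≈ constS (sgn (j ⊖ N)) ⊛ (q^ exponent (j ⊖ N) ⊛ [ suc (suc (N ℕ.+ N)) choose suc j ])
  term-suc N j rewrite ℤₚ.[1+m]⊖[1+n]≡m⊖n j N | ℕₚ.+-suc N N = ≈-refl

  move-monomial : ∀ {σ τ} x y z w X → x ℕ.+ y ≡ z ℕ.+ w → σ ≡ - τ →
    constS σ ⊛ (q^ x ⊛ (q^ y ⊛ X)) ≈ ⊝ (q^ z ⊛ (constS τ ⊛ (q^ w ⊛ X)))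
  move-monomial {σ} {τ} x y z w X x+y≡z+w σ≡-τ = begin
    constS σ ⊛ (q^ x ⊛ (q^ y ⊛ X))         ≈⟨ ⊛-cong σ≈-τ (≈-sym (⊛-assoc (q^ x) (q^ y) X)) ⟩
    ⊝ (constS τ) ⊛ ((q^ x ⊛ q^ y) ⊛ X)       ≈⟨ ⊛-congˡ (⊝ (constS τ)) (⊛-congʳ X (≈-trans (q^-+ x y)
                                                  (≈-trans (≡⇒≈ (cong q^_ x+y≡z+w)) (≈-sym (q^-+ z w))))) ⟩
    ⊝ (constS τ) ⊛ ((q^ z ⊛ q^ w) ⊛ X)
      ≈⟨ solve 4 (λ t z w x → (:- t) :* ((z :* w) :* x) := :- (z :* (t :* (w :* x)))) ≈-refl (constS τ) (q^ z) (q^ w) X ⟩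
    ⊝ (q^ z ⊛ (constS τ ⊛ (q^ w ⊛ X)))     ∎
    where
    open ≈-Reasoning
    σ≈-τ : constS σ ≈ ⊝ (constS τ)
    σ≈-τ = coeffwise λ n → trans (cong (_* oneS n) σ≡-τ) (sym (ℤₚ.neg-distribˡ-* τ (oneS n)))

  term-suc-0 : ∀ N → term (suc N) 0 ≈ ⊝ (q^ β N ⊛ term N 0)
  term-suc-0 N = begin
    constS σ ⊛ (q^ exponent (0 ⊖ suc N) ⊛ [ suc N ℕ.+ suc N choose 0 ])
      ≈⟨ ⊛-congˡ (constS σ) (⊛-congˡ (q^ exponent (0 ⊖ suc N)) (≈-trans (choose-zero (suc N ℕ.+ suc N))
           (≈-sym (≈-trans (⊛-congʳ [ N ℕ.+ N choose 0 ] Q^0) (≈-trans (⊛-identityˡ _) (choose-zero (N ℕ.+ N))))))) ⟩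
    constS σ ⊛ (q^ exponent (0 ⊖ suc N) ⊛ (q^ (s ℕ.* 0) ⊛ [ N ℕ.+ N choose 0 ]))
      ≈⟨ move-monomial (exponent (0 ⊖ suc N)) (s ℕ.* 0) (β N) (exponent (0 ⊖ N)) [ N ℕ.+ N choose 0 ]
           (trans (exponent-β 0 N) (cong (λ k → β N ℕ.+ exponent k) (ℤₚ.[1+m]⊖[1+n]≡m⊖n 0 N)))
           (trans (sgn-flip 0 (suc N)) (cong (λ k → - sgn k) (ℤₚ.[1+m]⊖[1+n]≡m⊖n 0 N))) ⟩
    ⊝ (q^ β N ⊛ term N 0) ∎
    where
    open ≈-Reasoning
    σ = sgn (0 ⊖ suc N)

  term-suc-1 : ∀ N → term (suc N) 1 ≈ term N 0 ⊕ Q^ suc (N ℕ.+ N) ⊛ term N 0 ⊕ ⊝ (q^ β N ⊛ term N 1)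
  term-suc-1 N = begin
    term (suc N) 1
      ≈⟨ term-suc N 0 ⟩
    σ ⊛ (x ⊛ [ suc (suc m) choose 1 ])
      ≈⟨ ⊛-congˡ σ (⊛-congˡ x (choose-+2-1 m)) ⟩
    σ ⊛ (x ⊛ ([ m choose 0 ] ⊕ Q^ suc m ⊛ [ m choose 0 ] ⊕ Q^ 1 ⊛ [ m choose 1 ]))
      ≈⟨ solve 5 (λ σ x a q y → σ :* (x :* (a :+ q :* a :+ y)) := σ :* (x :* a) :+ q :* (σ :* (x :* a)) :+ σ :* (x :* y)) ≈-refl
                 σ x [ m choose 0 ] (Q^ suc m) (Q^ 1 ⊛ [ m choose 1 ]) ⟩
    term N 0 ⊕ Q^ suc m ⊛ term N 0 ⊕ σ ⊛ (x ⊛ (Q^ 1 ⊛ [ m choose 1 ]))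
      ≈⟨ ⊕-congˡ (term N 0 ⊕ Q^ suc m ⊛ term N 0)
           (move-monomial (exponent (0 ⊖ N)) (s ℕ.* 1) (β N) (exponent (1 ⊖ N)) [ m choose 1 ] (exponent-β′ 0 N) (sgn-flip 0 N)) ⟩
    term N 0 ⊕ Q^ suc m ⊛ term N 0 ⊕ ⊝ (q^ β N ⊛ term N 1) ∎
    where
    open ≈-Reasoning
    m = N ℕ.+ N
    σ = constS (sgn (0 ⊖ N))
    x = q^ exponent (0 ⊖ N)

  term-suc-2+ : ∀ N j → term (suc N) (suc (suc j)) ≈
    term N (suc j) ⊕ Q^ suc (N ℕ.+ N) ⊛ term N (suc j) ⊕ ⊝ (q^ α N ⊛ term N j) ⊕ ⊝ (q^ β N ⊛ term N (suc (suc j)))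
  term-suc-2+ N j = begin
    term (suc N) (suc (suc j))
      ≈⟨ term-suc N (suc j) ⟩
    σ ⊛ (x ⊛ [ suc (suc m) choose suc (suc j) ])
      ≈⟨ ⊛-congˡ σ (⊛-congˡ x (choose-+2 m j)) ⟩
    σ ⊛ (x ⊛ ([ m choose suc j ] ⊕ Q^ suc m ⊛ [ m choose suc j ] ⊕ Q^ (m ∸ j) ⊛ [ m choose j ] ⊕ Q^ suc (suc j) ⊛ [ m choose suc (suc j) ]))
      ≈⟨ solve 6 (λ σ x b q y z → σ :* (x :* (b :+ q :* b :+ y :+ z)) := σ :* (x :* b) :+ q :* (σ :* (x :* b)) :+ σ :* (x :* y) :+ σ :* (x :* z)) ≈-refl
                 σ x [ m choose suc j ] (Q^ suc m) (Q^ (m ∸ j) ⊛ [ m choose j ]) (Q^ suc (suc j) ⊛ [ m choose suc (suc j) ]) ⟩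
    term N (suc j) ⊕ Q^ suc m ⊛ term N (suc j) ⊕ σ ⊛ (x ⊛ (Q^ (m ∸ j) ⊛ [ m choose j ])) ⊕ σ ⊛ (x ⊛ (Q^ suc (suc j) ⊛ [ m choose suc (suc j) ]))
      ≈⟨ ⊕-cong (⊕-congˡ (term N (suc j) ⊕ Q^ suc m ⊛ term N (suc j)) (lower (j ℕ.≤? m)))
           (move-monomial (exponent (suc j ⊖ N)) (s ℕ.* suc (suc j)) (β N) (exponent (suc (suc j) ⊖ N)) [ m choose suc (suc j) ]
              (exponent-β′ (suc j) N) (sgn-flip (suc j) N)) ⟩
    term N (suc j) ⊕ Q^ suc m ⊛ term N (suc j) ⊕ ⊝ (q^ α N ⊛ term N j) ⊕ ⊝ (q^ β N ⊛ term N (suc (suc j))) ∎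
    where
    open ≈-Reasoning
    m = N ℕ.+ N
    σ = constS (sgn (suc j ⊖ N))
    x = q^ exponent (suc j ⊖ N)
    lower : Dec (j ≤ m) → σ ⊛ (x ⊛ (Q^ (m ∸ j) ⊛ [ m choose j ])) ≈ ⊝ (q^ α N ⊛ term N j)
    lower (yes j≤m) = move-monomial (exponent (suc j ⊖ N)) (s ℕ.* (m ∸ j)) (α N) (exponent (j ⊖ N)) [ m choose j ]
                        (exponent-α j (m ∸ j) N (ℕₚ.m+[n∸m]≡n j≤m)) (sgn-suc j N)
    lower (no j≰m) = ≈-trans (⊛-annihilateʳ σ (⊛-annihilateʳ x (⊛-annihilateʳ (Q^ (m ∸ j)) (choose-> (ℕₚ.≰⇒> j≰m)))))
                             (≈-sym (≈-trans (⊝-cong (⊛-annihilateʳ (q^ α N) (term-> N j (ℕₚ.≰⇒> j≰m)))) (coeffwise λ _ → refl)))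

  tail₁ tail₂ : ℕ → Series
  tail₁ N = sumS (N ℕ.+ N) (λ j → term N (suc j))
  tail₂ N = sumS (N ℕ.+ N) (λ j → term N (suc (suc j)))

  finiteTheta-split : ∀ N → finiteTheta N ≈ term N 0 ⊕ tail₁ N
  finiteTheta-split N = ≈-trans (≈-sym (sumS-extend (N ℕ.+ N) (term N) (term-> N (suc (N ℕ.+ N)) ℕₚ.≤-refl)))
                                (sumS-shift (N ℕ.+ N) (term N))

  tail₁-split : ∀ N → tail₁ N ≈ term N 1 ⊕ tail₂ N
  tail₁-split N = ≈-trans (≈-sym (sumS-extend (N ℕ.+ N) (λ j → term N (suc j)) (term-> N (suc (suc (N ℕ.+ N))) (ℕₚ.n≤1+n _))))
                          (sumS-shift (N ℕ.+ N) (λ j → term N (suc j)))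

  q^α⊛q^β : ∀ N → q^ α N ⊛ q^ β N ≈ Q^ suc (N ℕ.+ N)
  q^α⊛q^β N = ≈-trans (q^-+ (α N) (β N)) (≡⇒≈ (cong q^_ (α+β a N)))
    where
    α+β : ∀ a N → (suc a ℕ.+ suc a) ℕ.* N ℕ.+ suc a ℕ.+ a ℕ.+ ((suc a ℕ.+ suc a) ℕ.* N ℕ.+ 1) ≡ (suc a ℕ.+ suc a) ℕ.* suc (N ℕ.+ N)
    α+β = ℕ-Solver.solve-∀

  sum-term-suc-2+ : ∀ N → sumS (N ℕ.+ N) (λ j → term (suc N) (suc (suc j))) ≈
    tail₁ N ⊕ Q^ suc (N ℕ.+ N) ⊛ tail₁ N ⊕ ⊝ (q^ α N ⊛ finiteTheta N) ⊕ ⊝ (q^ β N ⊛ tail₂ N)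
  sum-term-suc-2+ N = begin
    sumS m (λ j → term (suc N) (suc (suc j)))
      ≈⟨ sumS-cong m (λ j _ → term-suc-2+ N j) ⟩
    sumS m (λ j → t₁ j ⊕ Q ⊛ t₁ j ⊕ ⊝ (q^ α N ⊛ term N j) ⊕ ⊝ (q^ β N ⊛ t₂ j))
      ≈⟨ ≈-trans (sumS-⊕ m _ (λ j → ⊝ (q^ β N ⊛ t₂ j))) (⊕-congʳ _ (≈-trans (sumS-⊕ m _ (λ j → ⊝ (q^ α N ⊛ term N j)))
           (⊕-congʳ _ (sumS-⊕ m t₁ (λ j → Q ⊛ t₁ j))))) ⟩
    tail₁ N ⊕ sumS m (λ j → Q ⊛ t₁ j) ⊕ sumS m (λ j → ⊝ (q^ α N ⊛ term N j)) ⊕ sumS m (λ j → ⊝ (q^ β N ⊛ t₂ j))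
      ≈⟨ ⊕-cong (⊕-cong (⊕-congˡ (tail₁ N) (sumS-⊛ m Q t₁)) (sumS-⊝⊛ m (q^ α N) (term N))) (sumS-⊝⊛ m (q^ β N) t₂) ⟩
    tail₁ N ⊕ Q ⊛ tail₁ N ⊕ ⊝ (q^ α N ⊛ finiteTheta N) ⊕ ⊝ (q^ β N ⊛ tail₂ N) ∎
    where
    open ≈-Reasoning
    m = N ℕ.+ N
    Q = Q^ suc m
    t₁ t₂ : ℕ → Series
    t₁ j = term N (suc j)
    t₂ j = term N (suc (suc j))

  finiteTheta-suc : ∀ N → finiteTheta (suc N) ≈ factor (suc N) ⊛ finiteTheta N
  finiteTheta-suc N = begin
    finiteTheta (suc N)
      ≈⟨ ≡⇒≈ (cong (λ M → sumS (suc M) (term (suc N))) (ℕₚ.+-suc N N)) ⟩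
    sumS (suc (suc m)) (term (suc N))
      ≈⟨ ≈-trans (sumS-shift (suc m) (term (suc N))) (⊕-congˡ (term (suc N) 0) (sumS-shift m (λ j → term (suc N) (suc j)))) ⟩
    term (suc N) 0 ⊕ (term (suc N) 1 ⊕ sumS m (λ j → term (suc N) (suc (suc j))))
      ≈⟨ ⊕-cong (term-suc-0 N) (⊕-cong (term-suc-1 N) (sum-term-suc-2+ N)) ⟩
    ⊝ (qᵝ ⊛ t₀) ⊕ (t₀ ⊕ Q ⊛ t₀ ⊕ ⊝ (qᵝ ⊛ t₁) ⊕ (tail₁ N ⊕ Q ⊛ tail₁ N ⊕ ⊝ (qᵅ ⊛ finiteTheta N) ⊕ ⊝ (qᵝ ⊛ U₂)))
      ≈⟨ ⊕-congˡ (⊝ (qᵝ ⊛ t₀)) (⊕-cong (⊕-congʳ (⊝ (qᵝ ⊛ t₁)) (⊕-congˡ t₀ (⊛-congʳ t₀ Q≈)))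
           (⊕-congʳ (⊝ (qᵝ ⊛ U₂)) (⊕-cong (⊕-cong (tail₁-split N) (⊛-cong Q≈ (tail₁-split N))) (⊝-cong (⊛-congˡ qᵅ S≈))))) ⟩
    ⊝ (qᵝ ⊛ t₀) ⊕ (t₀ ⊕ (qᵅ ⊛ qᵝ) ⊛ t₀ ⊕ ⊝ (qᵝ ⊛ t₁) ⊕
      ((t₁ ⊕ U₂) ⊕ (qᵅ ⊛ qᵝ) ⊛ (t₁ ⊕ U₂) ⊕ ⊝ (qᵅ ⊛ (t₀ ⊕ (t₁ ⊕ U₂))) ⊕ ⊝ (qᵝ ⊛ U₂)))
      ≈⟨ solve 5 (λ t₀ t₁ u mα mβ → :- (mβ :* t₀) :+ (t₀ :+ (mα :* mβ) :* t₀ :+ :- (mβ :* t₁) :+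
                    ((t₁ :+ u) :+ (mα :* mβ) :* (t₁ :+ u) :+ :- (mα :* (t₀ :+ (t₁ :+ u))) :+ :- (mβ :* u)))
                   := ((con 1ℤ :- mα) :* (con 1ℤ :- mβ)) :* (t₀ :+ (t₁ :+ u))) ≈-refl t₀ t₁ U₂ qᵅ qᵝ ⟩
    ((constS 1ℤ ⊕ ⊝ qᵅ) ⊛ (constS 1ℤ ⊕ ⊝ qᵝ)) ⊛ (t₀ ⊕ (t₁ ⊕ U₂))
      ≈⟨ ⊛-congʳ (t₀ ⊕ (t₁ ⊕ U₂)) (⊛-cong (⊕-congʳ (⊝ qᵅ) constS-1) (⊕-congʳ (⊝ qᵝ) constS-1)) ⟩
    ((oneS ⊕ ⊝ qᵅ) ⊛ (oneS ⊕ ⊝ qᵝ)) ⊛ (t₀ ⊕ (t₁ ⊕ U₂))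
      ≈⟨ ⊛-cong (⊛-cong (oneMinusQ^-≈ (1≤α N)) (oneMinusQ^-≈ (1≤β N))) S≈ ⟨
    factor (suc N) ⊛ finiteTheta N ∎
    where
    open ≈-Reasoning
    m = N ℕ.+ N
    Q = Q^ suc m
    qᵅ = q^ α N
    qᵝ = q^ β N
    t₀ = term N 0
    t₁ = term N 1
    U₂ = tail₂ N
    Q≈ : Q ≈ qᵅ ⊛ qᵝ
    Q≈ = ≈-sym (q^α⊛q^β N)
    S≈ : finiteTheta N ≈ t₀ ⊕ (t₁ ⊕ U₂)
    S≈ = ≈-trans (finiteTheta-split N) (⊕-congˡ t₀ (tail₁-split N))

  finiteJacobi : ∀ N → finiteTheta N ≈ prodTo N factor
  finiteJacobi zero    = ≈-trans (⊛-congʳ (q^ 0 ⊛ oneS) constS-1) (≈-trans (⊛-identityˡ (q^ 0 ⊛ oneS)) (≈-trans (⊛-identityʳ (q^ 0)) q^0))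
  finiteJacobi (suc N) = ≈-trans (finiteTheta-suc N)
    (≈-trans (⊛-congˡ (factor (suc N)) (finiteJacobi N)) (⊛-comm (factor (suc N)) (prodTo N factor)))

  ∣k∣≤exponent : ∀ k → ℤ.∣ k ∣ ≤ exponent k
  ∣k∣≤exponent (+ zero)    = z≤n
  ∣k∣≤exponent (+ suc K)   = ℕₚ.m≤m*n (suc K) (c ℕ.* suc K ℕ.+ a)
  ∣k∣≤exponent ℤ.-[1+ L ]  = ℕₚ.m≤m*n (suc L) (c ℕ.* L ℕ.+ 1) {{ℕ.>-nonZero (ℕₚ.m≤n+m 1 (c ℕ.* L))}}

  -- how precisely f s ⊛ [2N choose j] ≈ 1 must hold for the j-th term to be exact below q^(N + 1)
  precision : ∀ N j → j ≤ N ℕ.+ N →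
    Σ ℕ λ M → M ≤ s ℕ.* suc j × M ≤ s ℕ.* suc (N ℕ.+ N ∸ j) × suc N ≤ exponent (j ⊖ N) ℕ.+ M
  precision N j j≤2N with j ℕ.≤? N
  ... | yes j≤N with ℕₚ.m≤n⇒∃[o]m+o≡n j≤N
  ...   | K , refl = s ℕ.* suc j , ℕₚ.≤-refl , ℕₚ.*-monoʳ-≤ s (s≤s j≤2N-j) , N<
    where
    j≤2N-j : j ≤ j ℕ.+ K ℕ.+ (j ℕ.+ K) ∸ j
    j≤2N-j = ℕₚ.≤-trans (ℕₚ.m≤m+n j K) (ℕₚ.≤-trans (ℕₚ.m≤n+m (j ℕ.+ K) K)
               (ℕₚ.≤-reflexive (sym (trans (cong (_∸ j) (ℕₚ.+-assoc j K (j ℕ.+ K))) (ℕₚ.m+n∸m≡n j _)))))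
    ∣k∣≡K : ℤ.∣ j ⊖ (j ℕ.+ K) ∣ ≡ K
    ∣k∣≡K = trans (ℤₚ.∣⊖∣-≤ (ℕₚ.m≤m+n j K)) (ℕₚ.m+n∸m≡n j K)
    N< : suc (j ℕ.+ K) ≤ exponent (j ⊖ (j ℕ.+ K)) ℕ.+ s ℕ.* suc j
    N< = ℕₚ.≤-trans (ℕₚ.≤-reflexive (trans (cong suc (ℕₚ.+-comm j K)) (sym (ℕₚ.+-suc K j))))
           (ℕₚ.+-mono-≤ (subst (_≤ exponent (j ⊖ (j ℕ.+ K))) ∣k∣≡K (∣k∣≤exponent (j ⊖ (j ℕ.+ K)))) (ℕₚ.m≤n*m (suc j) s))
  precision N j j≤2N | no j≰N with ℕₚ.m≤n⇒∃[o]m+o≡n (ℕₚ.<⇒≤ (ℕₚ.≰⇒> j≰N))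
  ... | K , refl = s ℕ.* suc (N ℕ.+ N ∸ (N ℕ.+ K)) , ℕₚ.*-monoʳ-≤ s (s≤s 2N-j≤j) , ℕₚ.≤-refl , N<
    where
    K≤N : K ≤ N
    K≤N = ℕₚ.+-cancelˡ-≤ N K N j≤2N
    2N-j≡N-K : N ℕ.+ N ∸ (N ℕ.+ K) ≡ N ∸ K
    2N-j≡N-K = ℕₚ.[m+n]∸[m+o]≡n∸o N N K
    2N-j≤j : N ℕ.+ N ∸ (N ℕ.+ K) ≤ N ℕ.+ K
    2N-j≤j = ℕₚ.≤-trans (ℕₚ.≤-reflexive 2N-j≡N-K) (ℕₚ.≤-trans (ℕₚ.m∸n≤m N K) (ℕₚ.m≤m+n N K))
    ∣k∣≡K : ℤ.∣ (N ℕ.+ K) ⊖ N ∣ ≡ K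
    ∣k∣≡K = trans (cong ℤ.∣_∣ (ℤₚ.⊖-≥ (ℕₚ.m≤m+n N K))) (ℕₚ.m+n∸m≡n N K)
    N< : suc N ≤ exponent ((N ℕ.+ K) ⊖ N) ℕ.+ s ℕ.* suc (N ℕ.+ N ∸ (N ℕ.+ K))
    N< = ℕₚ.≤-trans (ℕₚ.≤-reflexive (sym (trans (ℕₚ.+-suc K (N ∸ K)) (cong suc (ℕₚ.m+[n∸m]≡n K≤N)))))
           (ℕₚ.+-mono-≤ (subst (_≤ exponent ((N ℕ.+ K) ⊖ N)) ∣k∣≡K (∣k∣≤exponent ((N ℕ.+ K) ⊖ N)))
                        (ℕₚ.≤-trans (ℕₚ.≤-reflexive (cong suc (sym 2N-j≡N-K))) (ℕₚ.m≤n*m _ s)))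

  monomial : ℤ → Series
  monomial k = constS (sgn k) ⊛ q^ exponent k

  term-limit : ∀ {n N j} → n ≤ N → j ≤ N ℕ.+ N → (f s ⊛ term N j) n ≡ monomial (j ⊖ N) n
  term-limit {n} {N} {j} n≤N j≤2N with precision N j j≤2N
  ... | M , M≤ , M≤′ , N<E+M = trans (coeff rearrange n) (approximation n (ℕₚ.<-≤-trans (s≤s n≤N) N<E+M))
    where
    σ = constS (sgn (j ⊖ N))
    E = exponent (j ⊖ N)
    C = [ N ℕ.+ N choose j ]
    rearrange : f s ⊛ term N j ≈ σ ⊛ (q^ E ⊛ (f s ⊛ C))
    rearrange = solve 4 (λ F σ x C → F :* (σ :* (x :* C)) := σ :* (x :* (F :* C))) ≈-refl (f s) σ (q^ E) C
    approximation : σ ⊛ (q^ E ⊛ (f s ⊛ C)) ≈[ E ℕ.+ M ] monomial (j ⊖ N)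
    approximation = ⊛-cong[] (≈[]-refl {σ} _)
      (≈[]-trans (q^⊛-cong[] E (f⊛choose j≤2N M≤ M≤′)) (≈⇒≈[] _ (⊛-identityʳ (q^ E))))

  Convergent-factor : Convergent factor
  Convergent-factor (suc N) _ = ⊛-one[] (≈[]-weaken (ℕₚ.≤-trans (N<β N) (β≤α N)) (oneMinusQ^≈[] (1≤α N)))
                                        (≈[]-weaken (N<β N) (oneMinusQ^≈[] (1≤β N)))

  partialTheta : ℕ → Series
  partialTheta N = sumS (N ℕ.+ N) (λ j → monomial (j ⊖ N))

  f⊛∏factor≈[]partialTheta : ∀ N → f s ⊛ ∏ factor ≈[ suc N ] partialTheta N
  f⊛∏factor≈[]partialTheta N n n<1+N = begin
    (f s ⊛ ∏ factor) n                              ≡⟨ ⊛-cong[] (≈[]-refl {f s} (suc N)) (∏≈[]prodTo Convergent-factor N) n n<1+N ⟩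
    (f s ⊛ prodTo N factor) n                       ≡⟨ coeff (⊛-congˡ (f s) (finiteJacobi N)) n ⟨
    (f s ⊛ finiteTheta N) n                         ≡⟨ coeff (sumS-⊛ (N ℕ.+ N) (f s) (term N)) n ⟨
    sumTo (N ℕ.+ N) (λ j → (f s ⊛ term N j) n)      ≡⟨ sumTo-cong (N ℕ.+ N) (λ j j≤2N → term-limit (ℕₚ.≤-pred n<1+N) j≤2N) ⟩
    partialTheta N n                                ∎
    where open ≡-Reasoning

  theta : Series
  theta n = symmetricSum n monomial n

  jacobiTripleProduct : theta ≈ f s ⊛ ∏ factor
  jacobiTripleProduct = coeffwise λ n →
    sym (trans (f⊛∏factor≈[]partialTheta n n ℕₚ.≤-refl) (coeff (sumS-⊖ n monomial) n))

-- Two theta functions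

-- Θ₀.theta = Σ_k (-1)^k q^(k²) and Θ₂.theta = Σ_k (-1)^k q^(3k² + 2k)
module Θ₀ = JacobiTripleProduct 0
module Θ₂ = JacobiTripleProduct 2

odd : Family
odd zero    = oneS
odd (suc n) = oneMinusQ^ (2 ℕ.* n ℕ.+ 1)

Convergent-odd : Convergent odd
Convergent-odd (suc n) _ = ≈[]-weaken (ℕₚ.≤-trans (ℕₚ.≤-reflexive (ℕₚ.+-comm 1 n)) (ℕₚ.+-monoˡ-≤ 1 (ℕₚ.m≤n*m n 2)))
                                      (oneMinusQ^≈[] (ℕₚ.m≤n+m 1 (2 ℕ.* n)))

∏odd⊛f2 : ∏ odd ⊛ f 2 ≈ f 1
∏odd⊛f2 = begin
  ∏ odd ⊛ ∏ (f-factor 2)                  ≈⟨ ∏-⊛ Convergent-odd (Convergent-f 2) ⟩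
  ∏ (λ i → odd i ⊛ f-factor 2 i)          ≈⟨ ∏-cong odd⊛even ⟩
  ∏ (blocks 2 (f-factor 1))               ≈⟨ ∏-blocks 2 (Convergent-f 1) ⟩
  f 1                                     ∎
  where
  open ≈-Reasoning
  odd⊛even : ∀ i → 1 ≤ i → odd i ⊛ f-factor 2 i ≈ blocks 2 (f-factor 1) i
  odd⊛even (suc n) _ = ≈-sym (⊛-cong (≈-trans (⊛-identityˡ _) (oneMinusQ^-cong (ℕₚ.*-identityˡ _)))
                                      (oneMinusQ^-cong (even n)))
    where
    even : ∀ n → 1 ℕ.* (2 ℕ.* n ℕ.+ 2) ≡ 2 ℕ.* suc n
    even = ℕ-Solver.solve-∀

Θ₀-factor : ∀ i → 1 ≤ i → Θ₀.factor i ≈ odd i ⊛ odd i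
Θ₀-factor (suc N) _ = ⊛-congʳ (odd (suc N)) (oneMinusQ^-cong (ℕₚ.+-identityʳ _))

gauss : Θ₀.theta ⊛ f 2 ≈ f 1 ⊛ f 1
gauss = begin
  Θ₀.theta ⊛ f 2                   ≈⟨ ⊛-congʳ (f 2) Θ₀.jacobiTripleProduct ⟩
  (f 2 ⊛ ∏ Θ₀.factor) ⊛ f 2        ≈⟨ ⊛-congʳ (f 2) (⊛-congˡ (f 2) (≈-trans (∏-cong Θ₀-factor) (≈-sym (∏-⊛ Convergent-odd Convergent-odd)))) ⟩
  (f 2 ⊛ (∏ odd ⊛ ∏ odd)) ⊛ f 2    ≈⟨ solve 2 (λ F o → (F :* (o :* o)) :* F := (o :* F) :* (o :* F)) ≈-refl (f 2) (∏ odd) ⟩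
  (∏ odd ⊛ f 2) ⊛ (∏ odd ⊛ f 2)    ≈⟨ ⊛-cong ∏odd⊛f2 ∏odd⊛f2 ⟩
  f 1 ⊛ f 1                        ∎
  where open ≈-Reasoning

overpartitions : Series
overpartitions = f 2 ⊛ invf 1 ⊛ invf 1

θ₀⊛overpartitions : Θ₀.theta ⊛ overpartitions ≈ oneS
θ₀⊛overpartitions = begin
  Θ₀.theta ⊛ (f 2 ⊛ invf 1 ⊛ invf 1)       ≈⟨ solve 3 (λ θ F i → θ :* (F :* i :* i) := (θ :* F) :* i :* i) ≈-refl Θ₀.theta (f 2) (invf 1) ⟩
  (Θ₀.theta ⊛ f 2) ⊛ invf 1 ⊛ invf 1       ≈⟨ ⊛-congʳ (invf 1) (⊛-congʳ (invf 1) gauss) ⟩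
  (f 1 ⊛ f 1) ⊛ invf 1 ⊛ invf 1            ≈⟨ solve 2 (λ F i → F :* F :* i :* i := (F :* i) :* (F :* i)) ≈-refl (f 1) (invf 1) ⟩
  (f 1 ⊛ invf 1) ⊛ (f 1 ⊛ invf 1)          ≈⟨ ⊛-cong (f⊛invf 1) (f⊛invf 1) ⟩
  oneS ⊛ oneS                              ≈⟨ ⊛-identityˡ oneS ⟩
  oneS                                     ∎
  where open ≈-Reasoning

-- T = Σ_{k ≥ 1} (-1)^k q^(k²)
squares : ℕ → Series
squares zero    = zeroS
squares (suc N) = squares N ⊕ Θ₀.monomial (+ suc N)

T : Series
T n = squares n n

θ₀≈1+2T : Θ₀.theta ≈ oneS ⊕ constS (+ 2) ⊛ T
θ₀≈1+2T = coeffwise λ n → trans (coeff (symmetric n) n)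
  (cong₂ _+_ (coeff monomial₀≈1 n) (trans (doubling (T n)) (sym (coeff (constS-⊛ (+ 2) T) n))))
  where
  doubling : ∀ x → x + x ≡ + 2 * x
  doubling = solve-∀
  monomial₀≈1 : Θ₀.monomial (+ 0) ≈ oneS
  monomial₀≈1 = ≈-trans (⊛-congʳ (q^ 0) constS-1) (≈-trans (⊛-identityˡ (q^ 0)) q^0)
  mirror : ∀ N → Θ₀.monomial ℤ.-[1+ N ] ≈ Θ₀.monomial (+ suc N)
  mirror N = ⊛-congˡ (constS (Θ₀.sgn (+ suc N))) (≡⇒≈ (cong q^_ (square N)))
    where
    square : ∀ N → suc N ℕ.* (1 ℕ.* N ℕ.+ 1) ≡ suc N ℕ.* (1 ℕ.* suc N ℕ.+ 0)
    square = ℕ-Solver.solve-∀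
  symmetric : ∀ N → symmetricSum N Θ₀.monomial ≈ Θ₀.monomial (+ 0) ⊕ (squares N ⊕ squares N)
  symmetric zero    = ≈-sym (⊕-identityʳ (Θ₀.monomial (+ 0)))
  symmetric (suc N) = ≈-trans (⊕-cong (symmetric N) (⊕-congˡ (Θ₀.monomial (+ suc N)) (mirror N)))
    (solve 3 (λ m t x → m :+ (t :+ t) :+ (x :+ x) := m :+ ((t :+ x) :+ (t :+ x))) ≈-refl (Θ₀.monomial (+ 0)) (squares N) (Θ₀.monomial (+ suc N)))

-- Both sides are products over blocks of the six factors 1 - q^(6n + r), 1 ≤ r ≤ 6.
∏Θ₂-factor : ∏ Θ₂.factor ⊛ f 2 ⊛ f 3 ≈ f 1 ⊛ f 6
∏Θ₂-factor = begin
  ∏ Θ₂.factor ⊛ f 2 ⊛ f 3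
    ≈⟨ ⊛-cong (⊛-congˡ (∏ Θ₂.factor) (≈-sym (∏-blocks 3 (Convergent-f 2)))) (≈-sym (∏-blocks 2 (Convergent-f 3))) ⟩
  ∏ Θ₂.factor ⊛ ∏ B₃₂ ⊛ ∏ B₂₃
    ≈⟨ ⊛-congʳ (∏ B₂₃) (∏-⊛ Θ₂.Convergent-factor (Convergent-blocks 3 (Convergent-f 2))) ⟩
  ∏ (λ i → Θ₂.factor i ⊛ B₃₂ i) ⊛ ∏ B₂₃
    ≈⟨ ∏-⊛ (Convergent-⊛ Θ₂.Convergent-factor (Convergent-blocks 3 (Convergent-f 2))) (Convergent-blocks 2 (Convergent-f 3)) ⟩
  ∏ (λ i → Θ₂.factor i ⊛ B₃₂ i ⊛ B₂₃ i)
    ≈⟨ ∏-cong per-block ⟩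
  ∏ (λ i → B₆₁ i ⊛ f-factor 6 i)
    ≈⟨ ∏-⊛ (Convergent-blocks 6 (Convergent-f 1)) (Convergent-f 6) ⟨
  ∏ B₆₁ ⊛ f 6
    ≈⟨ ⊛-congʳ (f 6) (∏-blocks 6 (Convergent-f 1)) ⟩
  f 1 ⊛ f 6 ∎
  where
  open ≈-Reasoning
  B₃₂ = blocks 3 (f-factor 2)
  B₂₃ = blocks 2 (f-factor 3)
  B₆₁ = blocks 6 (f-factor 1)
  per-block : ∀ i → 1 ≤ i → Θ₂.factor i ⊛ B₃₂ i ⊛ B₂₃ i ≈ B₆₁ i ⊛ f-factor 6 i
  per-block (suc n) _ = begin
    Θ₂.factor (suc n) ⊛ B₃₂ (suc n) ⊛ B₂₃ (suc n)
      ≈⟨ ⊛-cong (⊛-cong (⊛-congʳ (A 1) (A-≡ (e₅ n)))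
                        (⊛-cong (⊛-cong (≈-trans (⊛-identityˡ _) (A-≡ (e₂ n))) (A-≡ (e₄ n))) (A-≡ (e₆ n))))
                (⊛-cong (≈-trans (⊛-identityˡ _) (A-≡ (e₃ n))) (A-≡ (e₆′ n))) ⟩
    (A 5 ⊛ A 1) ⊛ ((A 2 ⊛ A 4) ⊛ A 6) ⊛ (A 3 ⊛ A 6)
      ≈⟨ solve 6 (λ a₁ a₂ a₃ a₄ a₅ a₆ → (a₅ :* a₁) :* ((a₂ :* a₄) :* a₆) :* (a₃ :* a₆)
                                         := (((((a₁ :* a₂) :* a₃) :* a₄) :* a₅) :* a₆) :* a₆) ≈-refl
                 (A 1) (A 2) (A 3) (A 4) (A 5) (A 6) ⟩
    (((((A 1 ⊛ A 2) ⊛ A 3) ⊛ A 4) ⊛ A 5) ⊛ A 6) ⊛ A 6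
      ≈⟨ ⊛-cong six-residues (A-≡ (e₆″ n)) ⟨
    B₆₁ (suc n) ⊛ f-factor 6 (suc n) ∎
    where
    A : ℕ → Series
    A r = oneMinusQ^ (6 ℕ.* n ℕ.+ r)
    A-≡ : ∀ {k r} → k ≡ 6 ℕ.* n ℕ.+ r → oneMinusQ^ k ≈ A r
    A-≡ = oneMinusQ^-cong
    one : ∀ r → oneMinusQ^ (1 ℕ.* (6 ℕ.* n ℕ.+ r)) ≈ A r
    one r = A-≡ (ℕₚ.*-identityˡ _)
    six-residues : B₆₁ (suc n) ≈ ((((A 1 ⊛ A 2) ⊛ A 3) ⊛ A 4) ⊛ A 5) ⊛ A 6
    six-residues = ⊛-cong (⊛-cong (⊛-cong (⊛-cong (⊛-cong (≈-trans (⊛-identityˡ _) (one 1)) (one 2)) (one 3)) (one 4)) (one 5)) (one 6)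
    e₅ : ∀ n → 6 ℕ.* n ℕ.+ 3 ℕ.+ 2 ≡ 6 ℕ.* n ℕ.+ 5
    e₅ = ℕ-Solver.solve-∀
    e₂ : ∀ n → 2 ℕ.* (3 ℕ.* n ℕ.+ 1) ≡ 6 ℕ.* n ℕ.+ 2
    e₂ = ℕ-Solver.solve-∀
    e₄ : ∀ n → 2 ℕ.* (3 ℕ.* n ℕ.+ 2) ≡ 6 ℕ.* n ℕ.+ 4
    e₄ = ℕ-Solver.solve-∀
    e₆ : ∀ n → 2 ℕ.* (3 ℕ.* n ℕ.+ 3) ≡ 6 ℕ.* n ℕ.+ 6
    e₆ = ℕ-Solver.solve-∀
    e₃ : ∀ n → 3 ℕ.* (2 ℕ.* n ℕ.+ 1) ≡ 6 ℕ.* n ℕ.+ 3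
    e₃ = ℕ-Solver.solve-∀
    e₆′ : ∀ n → 3 ℕ.* (2 ℕ.* n ℕ.+ 2) ≡ 6 ℕ.* n ℕ.+ 6
    e₆′ = ℕ-Solver.solve-∀
    e₆″ : ∀ n → 6 ℕ.* suc n ≡ 6 ℕ.* n ℕ.+ 6
    e₆″ = ℕ-Solver.solve-∀

3[1+M]+1 : ∀ M → 3 ℕ.* suc M ℕ.+ 1 ≡ suc (suc (suc (3 ℕ.* M ℕ.+ 1)))
3[1+M]+1 = ℕ-Solver.solve-∀

-1^3m+1 : ∀ M → -1ℤ ℤ.^ (3 ℕ.* M ℕ.+ 1) ≡ -1ℤ ℤ.^ suc M
-1^3m+1 zero    = refl
-1^3m+1 (suc M) = begin
  -1ℤ ℤ.^ (3 ℕ.* suc M ℕ.+ 1)                        ≡⟨ cong (-1ℤ ℤ.^_) (3[1+M]+1 M) ⟩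
  -1ℤ * (-1ℤ * (-1ℤ * -1ℤ ℤ.^ (3 ℕ.* M ℕ.+ 1)))       ≡⟨ cong (λ x → -1ℤ * (-1ℤ * (-1ℤ * x))) (-1^3m+1 M) ⟩
  -1ℤ * (-1ℤ * (-1ℤ * -1ℤ ℤ.^ suc M))                 ≡⟨ cong (-1ℤ *_) (sym (ℤₚ.*-assoc -1ℤ -1ℤ _)) ⟩
  -1ℤ * (1ℤ * -1ℤ ℤ.^ suc M)                          ≡⟨ cong (-1ℤ *_) (ℤₚ.*-identityˡ _) ⟩
  -1ℤ ℤ.^ suc (suc M)                                ∎
  where open ≡-Reasoning

squares-+3 : ∀ M → squares (3 ℕ.* suc M ℕ.+ 1) ≈ squares (3 ℕ.* M ℕ.+ 1) ⊕ Θ₀.monomial (+ suc (3 ℕ.* M ℕ.+ 1))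
  ⊕ Θ₀.monomial (+ suc (suc (3 ℕ.* M ℕ.+ 1))) ⊕ Θ₀.monomial (+ suc (suc (suc (3 ℕ.* M ℕ.+ 1))))
squares-+3 M = ≡⇒≈ (cong squares (3[1+M]+1 M))

-- k = 3j ± 1 gives k² = 3 (3j² ± 2j) + 1, the exponents of Θ₂; the other squares are multiples of 3.
monomial-3M+2 : ∀ M → Θ₀.monomial (+ suc (3 ℕ.* M ℕ.+ 1)) ≈ constS (-1ℤ * Θ₂.sgn ℤ.-[1+ M ]) ⊛ q^ (3 ℕ.* Θ₂.exponent ℤ.-[1+ M ] ℕ.+ 1)
monomial-3M+2 M = ⊛-cong (≡⇒≈ (cong (λ x → constS (-1ℤ * x)) (-1^3m+1 M))) (≡⇒≈ (cong q^_ (square M)))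
  where
  square : ∀ M → suc (3 ℕ.* M ℕ.+ 1) ℕ.* (1 ℕ.* suc (3 ℕ.* M ℕ.+ 1) ℕ.+ 0) ≡ 3 ℕ.* (suc M ℕ.* (3 ℕ.* M ℕ.+ 1)) ℕ.+ 1
  square = ℕ-Solver.solve-∀

monomial-3M+3 : ∀ M → Θ₀.monomial (+ suc (suc (3 ℕ.* M ℕ.+ 1))) ≈
                      constS (Θ₀.sgn (+ suc (suc (3 ℕ.* M ℕ.+ 1)))) ⊛ q^ (3 ℕ.* (3 ℕ.* suc M ℕ.* suc M) ℕ.+ 0)
monomial-3M+3 M = ⊛-congˡ (constS (Θ₀.sgn (+ suc (suc (3 ℕ.* M ℕ.+ 1))))) (≡⇒≈ (cong q^_ (square M)))
  where
  square : ∀ M → suc (suc (3 ℕ.* M ℕ.+ 1)) ℕ.* (1 ℕ.* suc (suc (3 ℕ.* M ℕ.+ 1)) ℕ.+ 0) ≡ 3 ℕ.* (3 ℕ.* suc M ℕ.* suc M) ℕ.+ 0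
  square = ℕ-Solver.solve-∀

monomial-3M+4 : ∀ M → Θ₀.monomial (+ suc (suc (suc (3 ℕ.* M ℕ.+ 1)))) ≈ constS (-1ℤ * Θ₂.sgn (+ suc M)) ⊛ q^ (3 ℕ.* Θ₂.exponent (+ suc M) ℕ.+ 1)
monomial-3M+4 M = ⊛-cong (≡⇒≈ (cong (λ x → constS (-1ℤ * x)) sign)) (≡⇒≈ (cong q^_ (square M)))
  where
  sign : -1ℤ * (-1ℤ * -1ℤ ℤ.^ (3 ℕ.* M ℕ.+ 1)) ≡ -1ℤ ℤ.^ suc M
  sign = trans (sym (ℤₚ.*-assoc -1ℤ -1ℤ _)) (trans (ℤₚ.*-identityˡ _) (-1^3m+1 M))
  square : ∀ M → suc (suc (suc (3 ℕ.* M ℕ.+ 1))) ℕ.* (1 ℕ.* suc (suc (suc (3 ℕ.* M ℕ.+ 1))) ℕ.+ 0) ≡ 3 ℕ.* (suc M ℕ.* (3 ℕ.* suc M ℕ.+ 2)) ℕ.+ 1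
  square = ℕ-Solver.solve-∀

module _ (M : ℕ) where
  private
    σ₂ = Θ₀.sgn (+ suc (suc (3 ℕ.* M ℕ.+ 1)))
    x₂ = 3 ℕ.* suc M ℕ.* suc M
    0<3 : 0 < 3
    0<3 = s≤s z≤n
    1<3 : 1 < 3
    1<3 = s≤s (s≤s z≤n)
    2<3 : 2 < 3
    2<3 = s≤s (s≤s (s≤s z≤n))

  dissect-1-3M+2 : dissect 3 1 (Θ₀.monomial (+ suc (3 ℕ.* M ℕ.+ 1))) ≈ ⊝ Θ₂.monomial ℤ.-[1+ M ]
  dissect-1-3M+2 = ≈-trans (dissect-cong 3 1 (monomial-3M+2 M))
    (≈-trans (dissect-monomial 3 (-1ℤ * Θ₂.sgn ℤ.-[1+ M ]) (Θ₂.exponent ℤ.-[1+ M ]) 1<3) (constS-neg-⊛ (Θ₂.sgn ℤ.-[1+ M ]) (q^ Θ₂.exponent ℤ.-[1+ M ])))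

  dissect-1-3M+3 : dissect 3 1 (Θ₀.monomial (+ suc (suc (3 ℕ.* M ℕ.+ 1)))) ≈ zeroS
  dissect-1-3M+3 = ≈-trans (dissect-cong 3 1 (monomial-3M+3 M)) (dissect-monomial-≢ 3 σ₂ x₂ 1<3 0<3 λ ())

  dissect-1-3M+4 : dissect 3 1 (Θ₀.monomial (+ suc (suc (suc (3 ℕ.* M ℕ.+ 1))))) ≈ ⊝ Θ₂.monomial (+ suc M)
  dissect-1-3M+4 = ≈-trans (dissect-cong 3 1 (monomial-3M+4 M))
    (≈-trans (dissect-monomial 3 (-1ℤ * Θ₂.sgn (+ suc M)) (Θ₂.exponent (+ suc M)) 1<3) (constS-neg-⊛ (Θ₂.sgn (+ suc M)) (q^ Θ₂.exponent (+ suc M))))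

  dissect-2-3M+2 : dissect 3 2 (Θ₀.monomial (+ suc (3 ℕ.* M ℕ.+ 1))) ≈ zeroS
  dissect-2-3M+2 = ≈-trans (dissect-cong 3 2 (monomial-3M+2 M))
    (dissect-monomial-≢ 3 (-1ℤ * Θ₂.sgn ℤ.-[1+ M ]) (Θ₂.exponent ℤ.-[1+ M ]) 2<3 1<3 λ ())

  dissect-2-3M+3 : dissect 3 2 (Θ₀.monomial (+ suc (suc (3 ℕ.* M ℕ.+ 1)))) ≈ zeroS
  dissect-2-3M+3 = ≈-trans (dissect-cong 3 2 (monomial-3M+3 M)) (dissect-monomial-≢ 3 σ₂ x₂ 2<3 0<3 λ ())

  dissect-2-3M+4 : dissect 3 2 (Θ₀.monomial (+ suc (suc (suc (3 ℕ.* M ℕ.+ 1))))) ≈ zeroS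
  dissect-2-3M+4 = ≈-trans (dissect-cong 3 2 (monomial-3M+4 M))
    (dissect-monomial-≢ 3 (-1ℤ * Θ₂.sgn (+ suc M)) (Θ₂.exponent (+ suc M)) 2<3 1<3 λ ())

dissect-3-1-squares : ∀ M → dissect 3 1 (squares (3 ℕ.* M ℕ.+ 1)) ≈ ⊝ symmetricSum M Θ₂.monomial
dissect-3-1-squares zero    = coeffwise λ n → trans (ℤₚ.+-identityˡ _)
  (coeff (≈-trans (dissect-monomial 3 (-1ℤ * 1ℤ) 0 (s≤s (s≤s z≤n))) (constS-neg-⊛ 1ℤ (q^ 0))) n)
dissect-3-1-squares (suc M) = begin
  dissect 3 1 (squares (3 ℕ.* suc M ℕ.+ 1))
    ≈⟨ dissect-cong 3 1 (squares-+3 M) ⟩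
  dissect 3 1 (squares (3 ℕ.* M ℕ.+ 1)) ⊕ dissect 3 1 (Θ₀.monomial (+ suc (3 ℕ.* M ℕ.+ 1)))
    ⊕ dissect 3 1 (Θ₀.monomial (+ suc (suc (3 ℕ.* M ℕ.+ 1)))) ⊕ dissect 3 1 (Θ₀.monomial (+ suc (suc (suc (3 ℕ.* M ℕ.+ 1)))))
    ≈⟨ ⊕-cong (⊕-cong (⊕-cong (dissect-3-1-squares M) (dissect-1-3M+2 M)) (dissect-1-3M+3 M)) (dissect-1-3M+4 M) ⟩
  ⊝ symmetricSum M Θ₂.monomial ⊕ ⊝ Θ₂.monomial ℤ.-[1+ M ] ⊕ zeroS ⊕ ⊝ Θ₂.monomial (+ suc M)
    ≈⟨ ⊕-congʳ (⊝ Θ₂.monomial (+ suc M)) (⊕-identityʳ (⊝ symmetricSum M Θ₂.monomial ⊕ ⊝ Θ₂.monomial ℤ.-[1+ M ])) ⟩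
  ⊝ symmetricSum M Θ₂.monomial ⊕ ⊝ Θ₂.monomial ℤ.-[1+ M ] ⊕ ⊝ Θ₂.monomial (+ suc M)
    ≈⟨ solve 3 (λ S x y → :- S :+ :- y :+ :- x := :- (S :+ (x :+ y))) ≈-refl (symmetricSum M Θ₂.monomial) (Θ₂.monomial (+ suc M)) (Θ₂.monomial ℤ.-[1+ M ]) ⟩
  ⊝ symmetricSum (suc M) Θ₂.monomial ∎
  where open ≈-Reasoning

dissect-3-2-squares : ∀ M → dissect 3 2 (squares (3 ℕ.* M ℕ.+ 1)) ≈ zeroS
dissect-3-2-squares zero    = coeffwise λ n → trans (ℤₚ.+-identityˡ _)
  (coeff (dissect-monomial-≢ 3 (-1ℤ * 1ℤ) 0 (s≤s (s≤s (s≤s z≤n))) (s≤s (s≤s z≤n)) λ ()) n)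
dissect-3-2-squares (suc M) = ≈-trans (dissect-cong 3 2 (squares-+3 M)) (coeffwise λ n →
  cong₂ _+_ (cong₂ _+_ (cong₂ _+_ (coeff (dissect-3-2-squares M) n) (coeff (dissect-2-3M+2 M) n))
                       (coeff (dissect-2-3M+3 M) n)) (coeff (dissect-2-3M+4 M) n))

T-3n+1 : ∀ n → T (3 ℕ.* n ℕ.+ 1) ≡ - Θ₂.theta n
T-3n+1 n = coeff (dissect-3-1-squares n) n

T-3n+2 : ∀ n → T (3 ℕ.* n ℕ.+ 2) ≡ 0ℤ
T-3n+2 n = trans (cong (λ k → squares k (3 ℕ.* n ℕ.+ 2)) (ℕₚ.+-suc (3 ℕ.* n) 1))
  (cong₂ _+_ (coeff (dissect-3-2-squares n) n) (coeff (dissect-2-3M+2 n) n))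

-- The congruence

Rbar*6≈dilate⊛overpartitions : Rbar* 6 ≈ dilate 6 (f 1) ⊛ overpartitions
Rbar*6≈dilate⊛overpartitions =
  ≈-trans (solve 3 (λ F₂ F₆ i → F₂ :* F₆ :* i :* i := F₆ :* (F₂ :* i :* i)) ≈-refl (f 2) (f 6) (invf 1))
          (⊛-congʳ overpartitions (f-dilate 6 1))

-- the inverse of θ₀ = 1 + 2T modulo 8
1-2T+4T² : Series
1-2T+4T² = constS 1ℤ ⊕ constS (- + 2) ⊛ T ⊕ constS (+ 4) ⊛ (T ⊛ T)

overpartitions≡1-2T+4T² : overpartitions ≡[mod + 8 ] 1-2T+4T²
overpartitions≡1-2T+4T² = begin
  overpartitions
    ≈⟨ ≈⇒≡[mod] (+ 8) (solve 2 (λ t p → p := (con 1ℤ :+ con (- + 2) :* t :+ con (+ 4) :* (t :* t)) :* ((con 1ℤ :+ con (+ 2) :* t) :* p)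
                                              :+ con (- + 8) :* (t :* t :* t :* p)) ≈-refl T overpartitions) ⟩
  1-2T+4T² ⊛ ((constS 1ℤ ⊕ constS (+ 2) ⊛ T) ⊛ overpartitions) ⊕ constS (- + 8) ⊛ (T ⊛ T ⊛ T ⊛ overpartitions)
    ≈⟨ ⊕-cong-mod (≈⇒≡[mod] (+ 8) (⊛-congˡ 1-2T+4T² (≈-trans (⊛-congʳ overpartitions [1+2T]≈θ₀) θ₀⊛overpartitions)))
                  (≡[mod]-trans (constS-⊛-cong-mod (- + 8) (+ 8) T³P (divides (- + 2) refl)) (multiple≡[mod]0 (+ 8) T³P)) ⟩
  1-2T+4T² ⊛ oneS ⊕ zeroS
    ≈⟨ ≈⇒≡[mod] (+ 8) (≈-trans (⊕-identityʳ (1-2T+4T² ⊛ oneS)) (⊛-identityʳ 1-2T+4T²)) ⟩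
  1-2T+4T² ∎
  where
  open ≡[mod]-Reasoning (+ 8)
  T³P = T ⊛ T ⊛ T ⊛ overpartitions
  [1+2T]≈θ₀ : constS 1ℤ ⊕ constS (+ 2) ⊛ T ≈ Θ₀.theta
  [1+2T]≈θ₀ = ≈-trans (⊕-congʳ (constS (+ 2) ⊛ T) constS-1) (≈-sym θ₀≈1+2T)

dissect-6-2-1-2T+4T² : dissect 6 2 1-2T+4T² ≡[mod + 8 ] constS (+ 4) ⊛ Θ₂.theta
dissect-6-2-1-2T+4T² = begin
  dissect 6 2 1-2T+4T²
    ≈⟨ ≈⇒≡[mod] (+ 8) only-square ⟩
  dissect 6 2 (constS (+ 4) ⊛ (T ⊛ T))
    ≈⟨ dissect-cong-mod 6 2 (constS-⊛-mono-mod (+ 4) (frobenius T)) ⟩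
  dissect 6 2 (constS (+ 4) ⊛ dilate 2 T)
    ≈⟨ ≈⇒≡[mod] (+ 8) (≈-trans (dissect-constS-⊛ 6 2 (+ 4) (dilate 2 T)) (⊛-congˡ (constS (+ 4)) dilated)) ⟩
  constS (+ 4) ⊛ ⊝ Θ₂.theta
    ≈⟨ ≈⇒≡[mod] (+ 8) (solve 1 (λ θ → con (+ 4) :* (:- θ) := con (- + 4) :* θ) ≈-refl Θ₂.theta) ⟩
  constS (- + 4) ⊛ Θ₂.theta
    ≈⟨ constS-⊛-cong-mod (- + 4) (+ 4) Θ₂.theta (divides -1ℤ refl) ⟩
  constS (+ 4) ⊛ Θ₂.theta ∎
  where
  open ≡[mod]-Reasoning (+ 8)
  dilated : dissect 6 2 (dilate 2 T) ≈ ⊝ Θ₂.theta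
  dilated = coeffwise λ n → trans (cong (dilate 2 T) (six n)) (trans (dilate-* 2 T (3 ℕ.* n ℕ.+ 1)) (T-3n+1 n))
    where
    six : ∀ n → 6 ℕ.* n ℕ.+ 2 ≡ 2 ℕ.* (3 ℕ.* n ℕ.+ 1)
    six = ℕ-Solver.solve-∀
  only-square : dissect 6 2 1-2T+4T² ≈ dissect 6 2 (constS (+ 4) ⊛ (T ⊛ T))
  only-square = coeffwise λ n → trans (cong (λ x → x + (constS (+ 4) ⊛ (T ⊛ T)) (6 ℕ.* n ℕ.+ 2))
    (cong₂ _+_ (cong (1ℤ *_) (cong oneS (ℕₚ.+-comm (6 ℕ.* n) 2)))
               (trans (coeff (constS-⊛ (- + 2) T) (6 ℕ.* n ℕ.+ 2)) (cong (- + 2 *_) (trans (cong T (six n)) (T-3n+2 (2 ℕ.* n)))))))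
    (ℤₚ.+-identityˡ _)
    where
    six : ∀ n → 6 ℕ.* n ℕ.+ 2 ≡ 3 ℕ.* (2 ℕ.* n) ℕ.+ 2
    six = ℕ-Solver.solve-∀

f1⊛θ₂≈quotient : f 1 ⊛ Θ₂.theta ≈ ((f 1 ⊛ f 1) ⊛ (f 6 ⊛ f 6)) ⊛ (invf 2 ⊛ invf 3)
f1⊛θ₂≈quotient = ≈-sym (begin
  ((f 1 ⊛ f 1) ⊛ (f 6 ⊛ f 6)) ⊛ (invf 2 ⊛ invf 3)
    ≈⟨ solve 4 (λ a b i j → ((a :* a) :* (b :* b)) :* (i :* j) := (a :* b) :* (a :* b) :* (i :* j)) ≈-refl (f 1) (f 6) (invf 2) (invf 3) ⟩
  (f 1 ⊛ f 6) ⊛ (f 1 ⊛ f 6) ⊛ (invf 2 ⊛ invf 3)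
    ≈⟨ ⊛-congʳ (invf 2 ⊛ invf 3) (⊛-congˡ (f 1 ⊛ f 6) (≈-sym ∏Θ₂-factor)) ⟩
  (f 1 ⊛ f 6) ⊛ (∏ Θ₂.factor ⊛ f 2 ⊛ f 3) ⊛ (invf 2 ⊛ invf 3)
    ≈⟨ solve 7 (λ a b p c d i j → (a :* b) :* (p :* c :* d) :* (i :* j) := (a :* (b :* p)) :* ((c :* i) :* (d :* j))) ≈-refl
                (f 1) (f 6) (∏ Θ₂.factor) (f 2) (f 3) (invf 2) (invf 3) ⟩
  (f 1 ⊛ (f 6 ⊛ ∏ Θ₂.factor)) ⊛ ((f 2 ⊛ invf 2) ⊛ (f 3 ⊛ invf 3))
    ≈⟨ ⊛-congˡ (f 1 ⊛ (f 6 ⊛ ∏ Θ₂.factor)) (≈-trans (⊛-cong (f⊛invf 2) (f⊛invf 3)) (⊛-identityˡ oneS)) ⟩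
  (f 1 ⊛ (f 6 ⊛ ∏ Θ₂.factor)) ⊛ oneS
    ≈⟨ ≈-trans (⊛-identityʳ _) (⊛-congˡ (f 1) (≈-sym Θ₂.jacobiTripleProduct)) ⟩
  f 1 ⊛ Θ₂.theta ∎)
  where open ≈-Reasoning

-- f₁ θ₂ = f₁² f₆² / (f₂ f₃) ≡ f₂ f₃⁴ / (f₂ f₃) = f₃³ (mod 2)
f1⊛θ₂≡f3³ : f 1 ⊛ Θ₂.theta ≡[mod + 2 ] f 3 ⊛ f 3 ⊛ f 3
f1⊛θ₂≡f3³ = begin
  f 1 ⊛ Θ₂.theta
    ≈⟨ ≈⇒≡[mod] (+ 2) f1⊛θ₂≈quotient ⟩
  ((f 1 ⊛ f 1) ⊛ (f 6 ⊛ f 6)) ⊛ (invf 2 ⊛ invf 3)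
    ≈⟨ ⊛-cong-mod (⊛-cong-mod f1²≡f2 (⊛-cong-mod f6≡f3² f6≡f3²)) (≈⇒≡[mod] (+ 2) (≈-refl {invf 2 ⊛ invf 3})) ⟩
  (f 2 ⊛ ((f 3 ⊛ f 3) ⊛ (f 3 ⊛ f 3))) ⊛ (invf 2 ⊛ invf 3)
    ≈⟨ ≈⇒≡[mod] (+ 2) (solve 4 (λ a b i j → (a :* ((b :* b) :* (b :* b))) :* (i :* j) := (b :* b :* b) :* ((a :* i) :* (b :* j))) ≈-refl (f 2) (f 3) (invf 2) (invf 3)) ⟩
  (f 3 ⊛ f 3 ⊛ f 3) ⊛ ((f 2 ⊛ invf 2) ⊛ (f 3 ⊛ invf 3))
    ≈⟨ ≈⇒≡[mod] (+ 2) (≈-trans (⊛-congˡ (f 3 ⊛ f 3 ⊛ f 3) (≈-trans (⊛-cong (f⊛invf 2) (f⊛invf 3)) (⊛-identityˡ oneS))) (⊛-identityʳ _)) ⟩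
  f 3 ⊛ f 3 ⊛ f 3 ∎
  where
  open ≡[mod]-Reasoning (+ 2)
  f1²≡f2 : f 1 ⊛ f 1 ≡[mod + 2 ] f 2
  f1²≡f2 = ≡[mod]-trans (frobenius (f 1)) (≈⇒≡[mod] (+ 2) (≈-sym (f-dilate 2 1)))
  f6≡f3² : f 6 ≡[mod + 2 ] f 3 ⊛ f 3
  f6≡f3² = ≡[mod]-trans (≈⇒≡[mod] (+ 2) (f-dilate 2 3)) (≡[mod]-sym (frobenius (f 3)))

Rbar*6≡dilate⊛1-2T+4T² : Rbar* 6 ≡[mod + 8 ] dilate 6 (f 1) ⊛ 1-2T+4T²
Rbar*6≡dilate⊛1-2T+4T² = ≡[mod]-trans (≈⇒≡[mod] (+ 8) Rbar*6≈dilate⊛overpartitions)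
  (⊛-cong-mod (≈⇒≡[mod] (+ 8) (≈-refl {dilate 6 (f 1)})) overpartitions≡1-2T+4T²)

dissect-6-2-Rbar*6 : dissect 6 2 (Rbar* 6) ≡[mod + 8 ] constS (+ 4) ⊛ (f 3 ⊛ f 3 ⊛ f 3)
dissect-6-2-Rbar*6 = begin
  dissect 6 2 (Rbar* 6)
    ≈⟨ dissect-cong-mod 6 2 Rbar*6≡dilate⊛1-2T+4T² ⟩
  dissect 6 2 (dilate 6 (f 1) ⊛ 1-2T+4T²)
    ≈⟨ ≈⇒≡[mod] (+ 8) (dissect-dilate-⊛ 6 2 (f 1) 1-2T+4T² (s≤s (s≤s (s≤s z≤n)))) ⟩
  f 1 ⊛ dissect 6 2 1-2T+4T²
    ≈⟨ ⊛-cong-mod (≈⇒≡[mod] (+ 8) (≈-refl {f 1})) dissect-6-2-1-2T+4T² ⟩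
  f 1 ⊛ (constS (+ 4) ⊛ Θ₂.theta)
    ≈⟨ ≈⇒≡[mod] (+ 8) (solve 3 (λ a c θ → a :* (c :* θ) := c :* (a :* θ)) ≈-refl (f 1) (constS (+ 4)) Θ₂.theta) ⟩
  constS (+ 4) ⊛ (f 1 ⊛ Θ₂.theta)
    ≈⟨ constS-⊛-mono-mod (+ 4) f1⊛θ₂≡f3³ ⟩
  constS (+ 4) ⊛ (f 3 ⊛ f 3 ⊛ f 3) ∎
  where open ≡[mod]-Reasoning (+ 8)

f3³≈dilate-f1³ : f 3 ⊛ f 3 ⊛ f 3 ≈ dilate 3 (f 1 ⊛ f 1 ⊛ f 1)
f3³≈dilate-f1³ = ≈-trans (⊛-cong (⊛-cong (f-dilate 3 1) (f-dilate 3 1)) (f-dilate 3 1))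
  (≈-sym (≈-trans (dilate-⊛ 3 (f 1 ⊛ f 1) (f 1)) (⊛-congʳ (dilate 3 (f 1)) (dilate-⊛ 3 (f 1) (f 1)))))

lemma2p4 : ∀ (n : ℕ) →
    (+ 8) ∣ (Rbar* 6 (18 Data.Nat.* n Data.Nat.+ 2) - (+ 4) * (f 1 ⊛ f 1 ⊛ f 1) n)
lemma2p4 n = ℤ∣.∣⇒∣ᵤ (subst (+ 8 ∣ℤ_) (cong₂ _-_ (cong (Rbar* 6) (index n)) coefficient)
                                    (≡[mod]⇒∣ dissect-6-2-Rbar*6 (3 ℕ.* n)))
  where
  index : ∀ n → 6 ℕ.* (3 ℕ.* n) ℕ.+ 2 ≡ 18 ℕ.* n ℕ.+ 2
  index = ℕ-Solver.solve-∀
  coefficient : (constS (+ 4) ⊛ (f 3 ⊛ f 3 ⊛ f 3)) (3 ℕ.* n) ≡ + 4 * (f 1 ⊛ f 1 ⊛ f 1) n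
  coefficient = trans (coeff (constS-⊛ (+ 4) (f 3 ⊛ f 3 ⊛ f 3)) (3 ℕ.* n))
                      (cong (+ 4 *_) (trans (coeff f3³≈dilate-f1³ (3 ℕ.* n)) (dilate-* 3 (f 1 ⊛ f 1 ⊛ f 1) n)))
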